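{- If $n\geq 5$, then $\operatorname{mob}(K(n,2)) = \max \{ 4,\left \lfloor \frac{n-3}{2} \right \rfloor\}$.
   Context: For $n\ge 2k$, the Kneser graph $K(n,k)$ has all $k$-subsets of $[n]=\{1,\dots,n\}$ as vertices, two vertices adjacent if the sets are disjoint. A set $S$ of vertices is a general position set if no three distinct vertices of $S$ lie on a common shortest path. Place a robot on each vertex of a general position set $S$; robots move one at a time, a move being legal if the robot moves to an adjacent unoccupied vertex and the new set of occupied vertices is again in general position. $S$ is a mobile general position set if some sequence of legal moves lets every vertex be visited by at least one robot. $\operatorname{mob}(G)$ denotes the largest cardinality of a mobile general position set of $G$. -}

module Defs where

open import Level using (0ℓ)
open import Data.Nat using (ℕ; zero; suc; _≤_)
open import Data.Product using (Σ; ∃; ∃-syntax; _×_; _,_; proj₁)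
open import Data.List using (List; []; _∷_; length)
open import Data.List.Membership.Propositional using (_∈_; _∉_)
open import Data.List.Relation.Unary.Any using (Any)
open import Data.List.Relation.Unary.Unique.Propositional using (Unique)
open import Data.List.Relation.Unary.Linked using (Linked)
open import Data.List.Relation.Binary.Permutation.Propositional using (_↭_)
open import Data.Fin.Subset using (Subset; _∩_; ∣_∣; Empty)
open import Relation.Binary.PropositionalEquality using (_≡_; _≢_)
open import Relation.Nullary using (¬_)

record Graph : Set₁ where
  field
    V   : Set
    Adj : V → V → Set
open Graph public

Kneser : ℕ → ℕ → Graph
Kneser n k = record
  { V   = Σ (Subset n) (λ s → ∣ s ∣ ≡ k)
  ; Adj = λ s t → Empty (proj₁ s ∩ proj₁ t) }

module _ (G : Graph) where

  data Walk : V G → V G → Set where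
    here : ∀ u → Walk u u
    step : ∀ {u v w} → Adj G u v → Walk v w → Walk u w

  walkLength : ∀ {u w} → Walk u w → ℕ
  walkLength (here _)   = zero
  walkLength (step _ p) = suc (walkLength p)

  walkVertices : ∀ {u w} → Walk u w → List (V G)
  walkVertices (here u)          = u ∷ []
  walkVertices (step {u} _ p)    = u ∷ walkVertices p

  IsShortest : ∀ {u w} → Walk u w → Set
  IsShortest {u} {w} p = ∀ (q : Walk u w) → walkLength p ≤ walkLength q

  OnCommonShortestPath : V G → V G → V G → Set
  OnCommonShortestPath x y z =
    ∃[ u ] ∃[ w ] Σ (Walk u w) λ p →
      IsShortest p × x ∈ walkVertices p × y ∈ walkVertices p × z ∈ walkVertices p

  IsGeneralPosition : List (V G) → Set
  IsGeneralPosition S =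
    Unique S ×
    (∀ x y z → x ∈ S → y ∈ S → z ∈ S → x ≢ y → y ≢ z → x ≢ z →
       ¬ OnCommonShortestPath x y z)

  LegalMove : List (V G) → List (V G) → Set
  LegalMove S S′ =
    ∃[ u ] ∃[ v ] ∃[ R ]
      (S ↭ u ∷ R) × (S′ ≡ v ∷ R) × Adj G u v × v ∉ S × IsGeneralPosition S′

  IsMobileGeneralPosition : List (V G) → Set
  IsMobileGeneralPosition S =
    IsGeneralPosition S ×
    ∃[ Ss ] (Linked LegalMove (S ∷ Ss) ×
             (∀ (x : V G) → Any (x ∈_) (S ∷ Ss)))

  MobIs : ℕ → Set
  MobIs m =
    (∃[ S ] (IsMobileGeneralPosition S × length S ≡ m)) ×
    (∀ S → IsMobileGeneralPosition S → length S ≤ m)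

module Submission where

-- K(n,2) has diameter 2, so a set is in general position iff it induces no path on three
-- vertices. Once a robot has moved, the k − 1 ≥ 4 robots that stayed form a star (a common
-- point), a clique, or a set inside the four points of an edge yz. A star would have to
-- contain both ends of the move, which are disjoint. In the other two cases every later
-- configuration is trapped: inside the (k + 1)-clique of stayers and both ends of the move,
-- which covers all n ≤ 2k + 2 points, or inside the six vertices on the points of y and z;
-- either way some vertex is never visited. So a mobile set of size k ≥ 5 forces 2k + 3 ≤ n.
-- Conversely, four vertices through a common point are mobile, and so is a clique of m
-- vertices when 2m + 3 ≤ n, since a robot can always jump onto two points nobody covers.

open import Defs
open import Data.Nat using (ℕ; _≤_; _∸_; _⊔_)
open import Data.Nat.DivMod using (_/_)

open import Data.Nat using (zero; suc; _<_; _≤?_; z≤n; s≤s; _+_; _*_)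
open import Data.Nat.DivMod using (_%_; m≡m%n+[m/n]*n; m%n<n; m/n*n≤m)
import Data.Nat.Properties as ℕₚ
open import Data.Fin using (Fin; zero; suc)
import Data.Fin.Properties as Finₚ
open import Data.Fin.Subset using (Subset; ⁅_⁆; _∪_; ∣_∣; inside; outside)
  renaming (_∈_ to _∈ₛ_; _∉_ to _∉ₛ_)
import Data.Fin.Subset.Properties as Subsetₚ
open import Data.Vec.Base using (_∷_; [])
import Data.Vec.Base as Vec
import Data.Vec.Properties as Vecₚ
import Data.Bool.Properties as Boolₚ
open import Data.Product using (Σ; ∃-syntax; _×_; _,_; proj₁; proj₂)
open import Data.Sum using (_⊎_; inj₁; inj₂; [_,_])
import Data.Sum as Sum
open import Data.Empty using (⊥; ⊥-elim)
open import Function using (_∘_; id)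
open import Relation.Nullary using (¬_; Dec; yes; no)
open import Relation.Nullary.Decidable using (_×-dec_; _⊎-dec_; _→-dec_; ¬?; decidable-stable)
open import Relation.Unary using (Decidable)
open import Relation.Binary.PropositionalEquality hiding ([_])
open import Data.List using (List; []; _∷_; length; _++_; allFin; concatMap)
import Data.List.Properties as Listₚ
open import Data.List.Relation.Unary.Any using (Any; here; there; any?)
open import Data.List.Relation.Unary.Any.Properties using (singleton⁻)
open import Data.List.Relation.Unary.All using (All; []; _∷_)
import Data.List.Relation.Unary.All as All
open import Data.List.Relation.Unary.All.Properties using (¬Any⇒All¬)
open import Data.List.Relation.Unary.AllPairs using ([]; _∷_)
open import Data.List.Relation.Unary.Unique.Propositional using (Unique)
import Data.List.Relation.Unary.Unique.Propositional.Properties as Uniqueₚ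
open import Data.List.Membership.Propositional using (_∈_; _∉_; find; lose)
import Data.List.Membership.Propositional.Properties as ∈ₚ
import Data.List.Membership.DecPropositional as DecMembership
open import Data.List.Relation.Binary.Subset.Propositional using (_⊆_)
open import Data.List.Relation.Binary.Permutation.Propositional
  using (_↭_; prep; swap; ↭-sym; ↭⇒↭ₛ) renaming (refl to ↭-refl; trans to ↭-trans)
open import Data.List.Relation.Binary.Permutation.Propositional.Properties
  using (∈-resp-↭; ↭-length; shift)
import Data.List.Relation.Binary.Permutation.Setoid.Properties as ↭ₛₚ
open import Data.List.Relation.Unary.Linked using (Linked; [-]; _∷_)

module _ {A : Set} where

  ∈-remove : ∀ {x : A} {ys} → x ∈ ys →
             ∃[ ys′ ] length ys ≡ suc (length ys′) × (∀ {y} → y ∈ ys → y ≢ x → y ∈ ys′)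
  ∈-remove {ys = _ ∷ ys} (here refl) = ys , refl , λ { (here y≡x) y≢x → ⊥-elim (y≢x y≡x) ; (there y∈) _ → y∈ }
  ∈-remove {ys = z ∷ _} (there x∈) with ∈-remove x∈
  ... | ys′ , len , keep = z ∷ ys′ , cong suc len , λ { (here y≡z) _ → here y≡z ; (there y∈) y≢x → there (keep y∈ y≢x) }

  Unique-⊆⇒length≤ : ∀ {xs ys : List A} → Unique xs → xs ⊆ ys → length xs ≤ length ys
  Unique-⊆⇒length≤ {[]} _ _ = z≤n
  Unique-⊆⇒length≤ {x ∷ xs} {ys} (x∉xs ∷ uxs) xs⊆ys with ∈-remove (xs⊆ys (here refl))
  ... | ys′ , len , keep = subst (suc (length xs) ≤_) (sym len)
    (s≤s (Unique-⊆⇒length≤ uxs (λ y∈ → keep (xs⊆ys (there y∈)) (λ y≡x → All.lookup x∉xs y∈ (sym y≡x)))))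

  Unique-resp-↭ : ∀ {xs ys : List A} → xs ↭ ys → Unique xs → Unique ys
  Unique-resp-↭ xs↭ys = ↭ₛₚ.Unique-resp-↭ (setoid A) (↭⇒↭ₛ xs↭ys)

  Unique-head : ∀ {x : A} {xs} → Unique (x ∷ xs) → x ∉ xs
  Unique-head (x∉xs ∷ _) x∈xs = All.lookup x∉xs x∈xs refl

  Unique-tail : ∀ {x : A} {xs} → Unique (x ∷ xs) → Unique xs
  Unique-tail (_ ∷ uxs) = uxs

  ∉⇒All≢ : ∀ {x : A} {xs} → x ∉ xs → All (x ≢_) xs
  ∉⇒All≢ x∉ = All.tabulate λ y∈ x≡y → x∉ (subst (_∈ _) (sym x≡y) y∈)

  ∈⇒↭∷ : ∀ {x : A} {xs} → x ∈ xs → ∃[ ys ] xs ↭ x ∷ ys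
  ∈⇒↭∷ {x} x∈ with ∈ₚ.∈-∃++ x∈
  ... | ys , zs , refl = ys ++ zs , shift x ys zs

  find-or-refute : {P : A → Set} → Decidable P → ∀ xs → (∃[ x ] x ∈ xs × P x) ⊎ (∀ {x} → x ∈ xs → ¬ P x)
  find-or-refute P? xs with any? P? xs
  ... | yes some = inj₁ (find some)
  ... | no none = inj₂ (All.lookup (¬Any⇒All¬ xs none))

  ∉-pair-of-distinct : ∀ {a b x y z : A} → x ≢ y → y ≢ z → x ≢ z →
                       x ∈ a ∷ b ∷ [] → y ∈ a ∷ b ∷ [] → z ∈ a ∷ b ∷ [] → ⊥
  ∉-pair-of-distinct x≢y _ _ (here refl) (here refl) _ = x≢y refl
  ∉-pair-of-distinct x≢y _ _ (there (here refl)) (there (here refl)) _ = x≢y refl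
  ∉-pair-of-distinct _ _ x≢z (here refl) (there (here refl)) (here refl) = x≢z refl
  ∉-pair-of-distinct _ y≢z _ (here refl) (there (here refl)) (there (here refl)) = y≢z refl
  ∉-pair-of-distinct _ y≢z _ (there (here refl)) (here refl) (here refl) = y≢z refl
  ∉-pair-of-distinct _ _ x≢z (there (here refl)) (here refl) (there (here refl)) = x≢z refl

  triple-of-distinct-⊆ : ∀ {a b c x y z : A} → x ≢ y → y ≢ z → x ≢ z →
    x ∈ a ∷ b ∷ c ∷ [] → y ∈ a ∷ b ∷ c ∷ [] → z ∈ a ∷ b ∷ c ∷ [] → a ∷ b ∷ c ∷ [] ⊆ x ∷ y ∷ z ∷ []
  triple-of-distinct-⊆ {x = x} {y} {z} x≢y y≢z x≢z x∈ y∈ z∈ (here refl) = head x∈ y∈ z∈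
    where
    head : ∀ {a b c} → x ∈ a ∷ b ∷ c ∷ [] → y ∈ a ∷ b ∷ c ∷ [] → z ∈ a ∷ b ∷ c ∷ [] → a ∈ x ∷ y ∷ z ∷ []
    head (here refl) _ _ = here refl
    head (there _) (here refl) _ = there (here refl)
    head (there _) (there _) (here refl) = there (there (here refl))
    head (there x∈) (there y∈) (there z∈) = ⊥-elim (∉-pair-of-distinct x≢y y≢z x≢z x∈ y∈ z∈)
  triple-of-distinct-⊆ {a} {b} {c} x≢y y≢z x≢z x∈ y∈ z∈ (there (here refl)) =
    triple-of-distinct-⊆ x≢y y≢z x≢z (bac x∈) (bac y∈) (bac z∈) (here refl)
    where
    bac : a ∷ b ∷ c ∷ [] ⊆ b ∷ a ∷ c ∷ []
    bac = ∈-resp-↭ (swap a b ↭-refl)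
  triple-of-distinct-⊆ {a} {b} {c} x≢y y≢z x≢z x∈ y∈ z∈ (there (there (here refl))) =
    triple-of-distinct-⊆ x≢y y≢z x≢z (cab x∈) (cab y∈) (cab z∈) (here refl)
    where
    cab : a ∷ b ∷ c ∷ [] ⊆ c ∷ a ∷ b ∷ []
    cab = ∈-resp-↭ (↭-trans (prep a (swap b c ↭-refl)) (swap a c ↭-refl))

Unique-Fin-length≤ : ∀ {n} {xs : List (Fin n)} → Unique xs → length xs ≤ n
Unique-Fin-length≤ {n} {xs} uxs =
  subst (length xs ≤_) (Listₚ.length-tabulate {n = n} (λ i → i)) (Unique-⊆⇒length≤ uxs (λ {x} _ → ∈ₚ.∈-allFin x))

fresh : ∀ {n} (xs : List (Fin n)) → length xs < n → ∃[ d ] d ∉ xs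
fresh {n} xs len<n with Finₚ.any? (λ d → ¬? (DecMembership._∈?_ Finₚ._≟_ d xs))
... | yes d∉ = d∉
... | no none = ⊥-elim (ℕₚ.<⇒≱ len<n (subst (_≤ length xs) (Listₚ.length-tabulate {n = n} (λ i → i))
                  (Unique-⊆⇒length≤ (Uniqueₚ.allFin⁺ n)
                     (λ {d} _ → decidable-stable (DecMembership._∈?_ Finₚ._≟_ d xs) (λ d∉ → none (d , d∉))))))

record StarLeaves {n : ℕ} (c : Fin n) : Set where
  field
    a b d e : Fin n
    c≢a : c ≢ a
    c≢b : c ≢ b
    c≢d : c ≢ d
    c≢e : c ≢ e
    a≢b : a ≢ b
    a≢d : a ≢ d
    a≢e : a ≢ e
    b≢d : b ≢ d
    b≢e : b ≢ e
    d≢e : d ≢ e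

five-points : ∀ {n} → 5 ≤ n → Σ (Fin n) StarLeaves
five-points (s≤s (s≤s (s≤s (s≤s (s≤s _))))) = zero , record
  { a = suc zero ; b = suc (suc zero) ; d = suc (suc (suc zero)) ; e = suc (suc (suc (suc zero)))
  ; c≢a = λ () ; c≢b = λ () ; c≢d = λ () ; c≢e = λ () ; a≢b = λ ()
  ; a≢d = λ () ; a≢e = λ () ; b≢d = λ () ; b≢e = λ () ; d≢e = λ () }

module PairVertices (n : ℕ) where

  Vertex : Set
  Vertex = V (Kneser n 2)

  infix 4 _∋_ _~_

  _∋_ : Vertex → Fin n → Set
  v ∋ i = i ∈ₛ proj₁ v

  ∣s∣≡0⇒∉ : ∀ {m} (s : Subset m) → ∣ s ∣ ≡ 0 → ∀ i → i ∉ₛ s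
  ∣s∣≡0⇒∉ (inside ∷ s) () i
  ∣s∣≡0⇒∉ (outside ∷ s) e zero ()
  ∣s∣≡0⇒∉ (outside ∷ s) e (suc i) (Vec.there i∈) = ∣s∣≡0⇒∉ s e i i∈

  ∣s∣≡1⇒singleton : ∀ {m} (s : Subset m) → ∣ s ∣ ≡ 1 → ∃[ a ] a ∈ₛ s × (∀ i → i ∈ₛ s → i ≡ a)
  ∣s∣≡1⇒singleton (inside ∷ s) e =
    zero , Vec.here , λ { zero _ → refl ; (suc i) (Vec.there i∈) → ⊥-elim (∣s∣≡0⇒∉ s (ℕₚ.suc-injective e) i i∈) }
  ∣s∣≡1⇒singleton (outside ∷ s) e with ∣s∣≡1⇒singleton s e
  ... | a , a∈ , only = suc a , Vec.there a∈ , λ { zero () ; (suc i) (Vec.there i∈) → cong suc (only i i∈) }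

  record TwoElements {m} (s : Subset m) : Set where
    field
      fst snd : Fin m
      fst≢snd : fst ≢ snd
      fst∈ : fst ∈ₛ s
      snd∈ : snd ∈ₛ s
      only : ∀ i → i ∈ₛ s → i ≡ fst ⊎ i ≡ snd

  ∣s∣≡2⇒two-elements : ∀ {m} (s : Subset m) → ∣ s ∣ ≡ 2 → TwoElements s
  ∣s∣≡2⇒two-elements (inside ∷ s) e with ∣s∣≡1⇒singleton s (ℕₚ.suc-injective e)
  ... | b , b∈ , only = record
    { fst = zero ; snd = suc b ; fst≢snd = λ () ; fst∈ = Vec.here ; snd∈ = Vec.there b∈
    ; only = λ { zero _ → inj₁ refl ; (suc i) (Vec.there i∈) → inj₂ (cong suc (only i i∈)) } }
  ∣s∣≡2⇒two-elements (outside ∷ s) e with ∣s∣≡2⇒two-elements s e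
  ... | t = record
    { fst = suc fst ; snd = suc snd ; fst≢snd = fst≢snd ∘ Finₚ.suc-injective
    ; fst∈ = Vec.there fst∈ ; snd∈ = Vec.there snd∈
    ; only = λ { zero () ; (suc i) (Vec.there i∈) → Sum.map (cong suc) (cong suc) (only i i∈) } }
    where open TwoElements t

  private
    elements : (v : Vertex) → TwoElements (proj₁ v)
    elements (s , ∣s∣≡2) = ∣s∣≡2⇒two-elements s ∣s∣≡2

  pt₁ pt₂ : Vertex → Fin n
  pt₁ v = TwoElements.fst (elements v)
  pt₂ v = TwoElements.snd (elements v)

  pt₁≢pt₂ : (v : Vertex) → pt₁ v ≢ pt₂ v
  pt₁≢pt₂ v = TwoElements.fst≢snd (elements v)

  ∋pt₁ : (v : Vertex) → v ∋ pt₁ v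
  ∋pt₁ v = TwoElements.fst∈ (elements v)

  ∋pt₂ : (v : Vertex) → v ∋ pt₂ v
  ∋pt₂ v = TwoElements.snd∈ (elements v)

  ∋⇒pt : (v : Vertex) → ∀ {i} → v ∋ i → i ≡ pt₁ v ⊎ i ≡ pt₂ v
  ∋⇒pt v {i} = TwoElements.only (elements v) i

  ∣⁅a⁆∪⁅b⁆∣≡2 : ∀ {m} (a b : Fin m) → a ≢ b → ∣ ⁅ a ⁆ ∪ ⁅ b ⁆ ∣ ≡ 2
  ∣⁅a⁆∪⁅b⁆∣≡2 zero zero a≢b = ⊥-elim (a≢b refl)
  ∣⁅a⁆∪⁅b⁆∣≡2 {suc m} zero (suc b) _ = cong suc (trans (cong ∣_∣ (Subsetₚ.∪-identityˡ ⁅ b ⁆)) (Subsetₚ.∣⁅x⁆∣≡1 b))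
  ∣⁅a⁆∪⁅b⁆∣≡2 {suc m} (suc a) zero _ = cong suc (trans (cong ∣_∣ (Subsetₚ.∪-identityʳ ⁅ a ⁆)) (Subsetₚ.∣⁅x⁆∣≡1 a))
  ∣⁅a⁆∪⁅b⁆∣≡2 (suc a) (suc b) a≢b = ∣⁅a⁆∪⁅b⁆∣≡2 a b (a≢b ∘ cong suc)

  pair : (a b : Fin n) → a ≢ b → Vertex
  pair a b a≢b = ⁅ a ⁆ ∪ ⁅ b ⁆ , ∣⁅a⁆∪⁅b⁆∣≡2 a b a≢b

  pair∋ˡ : ∀ a b a≢b → pair a b a≢b ∋ a
  pair∋ˡ a b _ = Subsetₚ.x∈p∪q⁺ (inj₁ (Subsetₚ.x∈⁅x⁆ a))

  pair∋ʳ : ∀ a b a≢b → pair a b a≢b ∋ b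
  pair∋ʳ a b _ = Subsetₚ.x∈p∪q⁺ (inj₂ (Subsetₚ.x∈⁅x⁆ b))

  pair∋⇒ : ∀ a b a≢b {i} → pair a b a≢b ∋ i → i ≡ a ⊎ i ≡ b
  pair∋⇒ a b _ i∈ = Sum.map (Subsetₚ.x∈⁅y⁆⇒x≡y _) (Subsetₚ.x∈⁅y⁆⇒x≡y _) (Subsetₚ.x∈p∪q⁻ _ _ i∈)

  pair∌ : ∀ {a b c} {a≢b : a ≢ b} → c ≢ a → c ≢ b → ¬ pair a b a≢b ∋ c
  pair∌ {a} {b} {a≢b = a≢b} c≢a c≢b c∈ = [ c≢a , c≢b ] (pair∋⇒ a b a≢b c∈)

  vertex-≡ : (u w : Vertex) → proj₁ u ≡ proj₁ w → u ≡ w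
  vertex-≡ (s , e) (.s , e′) refl = cong (s ,_) (ℕₚ.≡-irrelevant e e′)

  ∋-distinct⇒only : (w : Vertex) {x y : Fin n} → w ∋ x → w ∋ y → x ≢ y → ∀ {i} → w ∋ i → i ≡ x ⊎ i ≡ y
  ∋-distinct⇒only w x∈ y∈ x≢y i∈ with ∋⇒pt w x∈ | ∋⇒pt w y∈ | ∋⇒pt w i∈
  ... | inj₁ refl | inj₁ refl | _ = ⊥-elim (x≢y refl)
  ... | inj₂ refl | inj₂ refl | _ = ⊥-elim (x≢y refl)
  ... | inj₁ refl | inj₂ refl | inj₁ refl = inj₁ refl
  ... | inj₁ refl | inj₂ refl | inj₂ refl = inj₂ refl
  ... | inj₂ refl | inj₁ refl | inj₁ refl = inj₂ refl
  ... | inj₂ refl | inj₁ refl | inj₂ refl = inj₁ refl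

  ⊆⇒≡ : (u w : Vertex) → (∀ {i} → u ∋ i → w ∋ i) → u ≡ w
  ⊆⇒≡ u w u⊆w = vertex-≡ u w (Subsetₚ.⊆-antisym (λ {i} → u⊆w) w⊆u)
    where
    w⊆u : ∀ {i} → w ∋ i → u ∋ i
    w⊆u i∈ with ∋-distinct⇒only w (u⊆w (∋pt₁ u)) (u⊆w (∋pt₂ u)) (pt₁≢pt₂ u) i∈
    ... | inj₁ refl = ∋pt₁ u
    ... | inj₂ refl = ∋pt₂ u

  share-two⇒≡ : (u w : Vertex) {x y : Fin n} → x ≢ y → u ∋ x → u ∋ y → w ∋ x → w ∋ y → u ≡ w
  share-two⇒≡ u w x≢y ux uy wx wy =
    ⊆⇒≡ u w λ ui → [ (λ { refl → wx }) , (λ { refl → wy }) ] (∋-distinct⇒only u ux uy x≢y ui)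

  pair-pts : (v : Vertex) → v ≡ pair (pt₁ v) (pt₂ v) (pt₁≢pt₂ v)
  pair-pts v = share-two⇒≡ v _ (pt₁≢pt₂ v) (∋pt₁ v) (∋pt₂ v) (pair∋ˡ _ _ (pt₁≢pt₂ v)) (pair∋ʳ _ _ (pt₁≢pt₂ v))

  pair-≢ : ∀ {c x y} {c≢x : c ≢ x} {c≢y : c ≢ y} → x ≢ y → pair c x c≢x ≢ pair c y c≢y
  pair-≢ {c} {x} {y} {c≢x} {c≢y} x≢y eq =
    [ (λ y≡c → c≢y (sym y≡c)) , (λ y≡x → x≢y (sym y≡x)) ] (pair∋⇒ c x c≢x (subst (_∋ y) (sym eq) (pair∋ʳ c y c≢y)))

  other-point : (w : Vertex) (i : Fin n) → w ∋ i → ∃[ o ] w ∋ o × i ≢ o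
  other-point w i _ with i Finₚ.≟ pt₁ w
  ... | yes refl = pt₂ w , ∋pt₂ w , pt₁≢pt₂ w
  ... | no i≢pt₁ = pt₁ w , ∋pt₁ w , i≢pt₁

  _≟_ : (u w : Vertex) → Dec (u ≡ w)
  u ≟ w with Vecₚ.≡-dec Boolₚ._≟_ (proj₁ u) (proj₁ w)
  ... | yes eq = yes (vertex-≡ u w eq)
  ... | no neq = no (neq ∘ cong proj₁)

  _∋?_ : (t : Vertex) (i : Fin n) → Dec (t ∋ i)
  t ∋? i = i Subsetₚ.∈? proj₁ t

  -- A record rather than a synonym for Adj, so that u and w can be inferred from a proof of u ~ w.
  record _~_ (u w : Vertex) : Set where
    constructor adj
    field disjoint : Adj (Kneser n 2) u w
  open _~_ public

  data Meet (u w : Vertex) : Set where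
    meet : ∀ i → u ∋ i → w ∋ i → Meet u w

  ~⇒¬Meet : ∀ {u w} → u ~ w → ¬ Meet u w
  ~⇒¬Meet (adj u∩w≡∅) (meet i ui wi) = u∩w≡∅ (i , Subsetₚ.x∈p∩q⁺ (ui , wi))

  ¬Meet⇒~ : ∀ {u w} → ¬ Meet u w → u ~ w
  ¬Meet⇒~ {u} {w} ¬meet = adj λ (i , i∈) → let (ui , wi) = Subsetₚ.x∈p∩q⁻ (proj₁ u) (proj₁ w) i∈ in ¬meet (meet i ui wi)

  Meet? : (u w : Vertex) → Dec (Meet u w)
  Meet? u w with Finₚ.any? (λ i → (u ∋? i) ×-dec (w ∋? i))
  ... | yes (i , ui , wi) = yes (meet i ui wi)
  ... | no none = no λ { (meet i ui wi) → none (i , ui , wi) }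

  _~?_ : (u w : Vertex) → Dec (u ~ w)
  u ~? w with Meet? u w
  ... | yes m = no (λ u~w → ~⇒¬Meet u~w m)
  ... | no ¬m = yes (¬Meet⇒~ ¬m)

  ≁⇒Meet : ∀ {u w} → ¬ u ~ w → Meet u w
  ≁⇒Meet {u} {w} u≁w with Meet? u w
  ... | yes m = m
  ... | no ¬m = ⊥-elim (u≁w (¬Meet⇒~ ¬m))

  ~-disjoint : ∀ {u w i} → u ~ w → u ∋ i → w ∋ i → ⊥
  ~-disjoint {i = i} u~w ui wi = ~⇒¬Meet u~w (meet i ui wi)

  disjoint⇒~ : ∀ {u w} → (∀ i → u ∋ i → w ∋ i → ⊥) → u ~ w
  disjoint⇒~ disj = ¬Meet⇒~ λ { (meet i ui wi) → disj i ui wi }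

  ~-sym : ∀ {u w} → u ~ w → w ~ u
  ~-sym u~w = disjoint⇒~ λ i wi ui → ~-disjoint u~w ui wi

  ~-irrefl : ∀ {u} → ¬ u ~ u
  ~-irrefl {u} u~u = ~-disjoint u~u (∋pt₁ u) (∋pt₁ u)

  ~⇒≢ : ∀ {u w} → u ~ w → u ≢ w
  ~⇒≢ u~w refl = ~-irrefl u~w

  pair~ : ∀ {a b a≢b w} → ¬ w ∋ a → ¬ w ∋ b → pair a b a≢b ~ w
  pair~ {a} {b} {a≢b} w∌a w∌b = disjoint⇒~ λ i i∈ wi → [ (λ { refl → w∌a wi }) , (λ { refl → w∌b wi }) ] (pair∋⇒ a b a≢b i∈)

  pair~pair : ∀ {a b c d} {a≢b : a ≢ b} {c≢d : c ≢ d} → a ≢ c → a ≢ d → b ≢ c → b ≢ d → pair a b a≢b ~ pair c d c≢d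
  pair~pair {c≢d = c≢d} a≢c a≢d b≢c b≢d = pair~ (pair∌ {a≢b = c≢d} a≢c a≢d) (pair∌ {a≢b = c≢d} b≢c b≢d)

module GeneralPosition (n : ℕ) (5≤n : 5 ≤ n) where

  open PairVertices n

  K : Graph
  K = Kneser n 2

  P₃-free : List Vertex → Set
  P₃-free C = ∀ {u m w} → u ∈ C → m ∈ C → w ∈ C → u ≢ w → u ~ m → m ~ w → u ~ w

  P₃-free-⊆ : ∀ {C D} → C ⊆ D → P₃-free D → P₃-free C
  P₃-free-⊆ C⊆D free-D u∈ m∈ w∈ = free-D (C⊆D u∈) (C⊆D m∈) (C⊆D w∈)

  diameter≤2 : ∀ u w → Σ (Walk K u w) λ p → walkLength K p ≤ 2
  diameter≤2 u w with u ≟ w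
  ... | yes refl = here u , z≤n
  ... | no _ with u ~? w
  ... | yes (adj u∩w≡∅) = step u∩w≡∅ (here w) , s≤s z≤n
  ... | no u≁w with ≁⇒Meet u≁w
  ... | meet i ui wi with other-point w i wi
  ... | o , wo , i≢o with fresh (pt₁ u ∷ pt₂ u ∷ o ∷ []) (ℕₚ.≤-trans (s≤s (s≤s (s≤s (s≤s z≤n)))) 5≤n)
  ... | d , d∉ with fresh (d ∷ pt₁ u ∷ pt₂ u ∷ o ∷ []) 5≤n
  ... | e , e∉ = step {v = pair d e d≢e} (disjoint (~-sym m~u)) (step (disjoint m~w) (here w)) , s≤s (s≤s z≤n)
    where
    d≢e : d ≢ e
    d≢e d≡e = e∉ (here (sym d≡e))
    u∌ : ∀ {x} → x ∉ pt₁ u ∷ pt₂ u ∷ o ∷ [] → ¬ u ∋ x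
    u∌ x∉ ux = [ (λ x≡pt₁ → x∉ (here x≡pt₁)) , (λ x≡pt₂ → x∉ (there (here x≡pt₂))) ] (∋⇒pt u ux)
    w∌ : ∀ {x} → x ∉ pt₁ u ∷ pt₂ u ∷ o ∷ [] → ¬ w ∋ x
    w∌ x∉ wx = [ (λ { refl → u∌ x∉ ui }) , (λ { refl → x∉ (there (there (here refl))) }) ]
                 (∋-distinct⇒only w wi wo i≢o wx)
    m~u : pair d e d≢e ~ u
    m~u = pair~ (u∌ d∉) (u∌ (e∉ ∘ there))
    m~w : pair d e d≢e ~ w
    m~w = pair~ (w∌ d∉) (w∌ (e∉ ∘ there))

  ≁⇒walkLength≥2 : ∀ {u w} → u ≢ w → ¬ u ~ w → (p : Walk K u w) → 2 ≤ walkLength K p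
  ≁⇒walkLength≥2 u≢w _ (here _) = ⊥-elim (u≢w refl)
  ≁⇒walkLength≥2 _ u≁w (step u∩w≡∅ (here _)) = ⊥-elim (u≁w (adj u∩w≡∅))
  ≁⇒walkLength≥2 _ _ (step _ (step _ _)) = s≤s (s≤s z≤n)

  gp⇒P₃-free : ∀ {C} → IsGeneralPosition K C → P₃-free C
  gp⇒P₃-free (_ , gp) {u} {m} {w} u∈ m∈ w∈ u≢w u~m m~w with u ~? w
  ... | yes u~w = u~w
  ... | no u≁w = ⊥-elim (gp u m w u∈ m∈ w∈ (~⇒≢ u~m) (~⇒≢ m~w) u≢w
          (u , w , step {v = m} (disjoint u~m) (step (disjoint m~w) (here w)) , ≁⇒walkLength≥2 u≢w u≁w
           , here refl , there (here refl) , there (there (here refl))))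

  P₃-free⇒gp : ∀ {C} → Unique C → P₃-free C → IsGeneralPosition K C
  P₃-free⇒gp {C} uC free = uC , λ x y z x∈ y∈ z∈ x≢y y≢z x≢z (_ , _ , p , shortest , xp , yp , zp) →
    no-shortest-path x∈ y∈ z∈ x≢y y≢z x≢z p shortest xp yp zp
    where
    no-shortest-path : ∀ {x y z} → x ∈ C → y ∈ C → z ∈ C → x ≢ y → y ≢ z → x ≢ z →
      ∀ {u w} (p : Walk K u w) → IsShortest K p →
      x ∈ walkVertices K p → y ∈ walkVertices K p → z ∈ walkVertices K p → ⊥
    no-shortest-path _ _ _ x≢y _ _ (here _) _ (here refl) (here refl) _ = x≢y refl
    no-shortest-path _ _ _ x≢y y≢z x≢z (step _ (here _)) _ xp yp zp = ∉-pair-of-distinct x≢y y≢z x≢z xp yp zp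
    no-shortest-path x∈ y∈ z∈ x≢y y≢z x≢z {u} {w} (step {v = m} u∩m≡∅ (step m∩w≡∅ (here _))) shortest xp yp zp =
      u≁w (free (on-path (here refl)) (on-path (there (here refl))) (on-path (there (there (here refl))))
                 u≢w (adj u∩m≡∅) (adj m∩w≡∅))
      where
      u≁w : ¬ u ~ w
      u≁w (adj u∩w≡∅) with shortest (step u∩w≡∅ (here w))
      ... | s≤s ()
      u≢w : u ≢ w
      u≢w refl with shortest (here u)
      ... | ()
      on-path : u ∷ m ∷ w ∷ [] ⊆ C
      on-path t∈ with triple-of-distinct-⊆ x≢y y≢z x≢z xp yp zp t∈
      ... | here refl = x∈
      ... | there (here refl) = y∈
      ... | there (there (here refl)) = z∈
    no-shortest-path _ _ _ _ _ _ {u} {w} (step _ (step _ (step _ _))) shortest _ _ _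
      with ℕₚ.≤-trans (shortest (proj₁ (diameter≤2 u w))) (proj₂ (diameter≤2 u w))
    ... | s≤s (s≤s ())

module P₃FreeSets (n : ℕ) (5≤n : 5 ≤ n) where

  open PairVertices n
  open GeneralPosition n 5≤n

  Clique : List Vertex → Set
  Clique C = ∀ {y z} → y ∈ C → z ∈ C → y ≢ z → y ~ z

  Star : Fin n → List Vertex → Set
  Star c C = ∀ {y} → y ∈ C → y ∋ c

  Within : Vertex → Vertex → Vertex → Set
  Within y z t = ∀ i → t ∋ i → y ∋ i ⊎ z ∋ i

  data Shape (R : List Vertex) : Set where
    star : ∀ c → Star c R → Shape R
    clique : Clique R → Shape R
    within : ∀ {y z} → y ∈ R → z ∈ R → y ~ z → (∀ {t} → t ∈ R → Within y z t) → Shape R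

  NoCommonPoint : Vertex → Vertex → Vertex → Set
  NoCommonPoint w r r′ = ∀ {j} → w ∋ j → r ∋ j → r′ ∋ j → ⊥

  NoCommonPoints : Vertex → List Vertex → Set
  NoCommonPoints w R = ∀ {r r′} → r ∈ R → r′ ∈ R → r ≢ r′ → NoCommonPoint w r r′

  Within? : ∀ y z t → Dec (Within y z t)
  Within? y z t = Finₚ.all? λ i → (t ∋? i) →-dec ((y ∋? i) ⊎-dec (z ∋? i))

  ¬Within⇒outside-point : ∀ y z t → ¬ Within y z t → ∃[ e ] t ∋ e × ¬ (y ∋ e ⊎ z ∋ e)
  ¬Within⇒outside-point y z t ¬within with Finₚ.¬∀⟶∃¬ n _ (λ i → (t ∋? i) →-dec ((y ∋? i) ⊎-dec (z ∋? i))) ¬within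
  ... | e , ¬[te→yz] = e , decidable-stable (t ∋? e) (λ t∌e → ¬[te→yz] (⊥-elim ∘ t∌e)) , ¬[te→yz] ∘ (λ yz _ → yz)

  ∃-∈-∉ : ∀ {R L : List Vertex} → Unique R → length L < length R → ∃[ t ] t ∈ R × t ∉ L
  ∃-∈-∉ {R} {L} uR len< with find-or-refute (λ t → ¬? (DecMembership._∈?_ _≟_ t L)) R
  ... | inj₁ found = found
  ... | inj₂ none = ⊥-elim (ℕₚ.<⇒≱ len< (Unique-⊆⇒length≤ uR λ {t} t∈ → decidable-stable (DecMembership._∈?_ _≟_ t L) (none t∈)))

  Meet⇒∋other : ∀ {t r c d} → ¬ t ∋ c → r ∋ c → r ∋ d → c ≢ d → Meet t r → t ∋ d
  Meet⇒∋other {r = r} t∌c rc rd c≢d (meet j tj rj) =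
    [ (λ { refl → ⊥-elim (t∌c tj) }) , (λ { refl → tj }) ] (∋-distinct⇒only r rc rd c≢d rj)

  -- Each point of w lies in at most one of a, b, c, so w misses one of them.
  ~-one-of-three : ∀ {w a b c} → NoCommonPoint w a b → NoCommonPoint w b c → NoCommonPoint w a c →
                   a ~ w ⊎ b ~ w ⊎ c ~ w
  ~-one-of-three {w} {a} {b} {c} ab bc ac with a ~? w | b ~? w | c ~? w
  ... | yes a~w | _ | _ = inj₁ a~w
  ... | no _ | yes b~w | _ = inj₂ (inj₁ b~w)
  ... | no _ | no _ | yes c~w = inj₂ (inj₂ c~w)
  ... | no a≁w | no b≁w | no c≁w with ≁⇒Meet a≁w | ≁⇒Meet b≁w | ≁⇒Meet c≁w
  ... | meet _ aj wj | meet _ bk wk | meet _ cl wl with ∋⇒pt w wj | ∋⇒pt w wk | ∋⇒pt w wl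
  ... | inj₁ refl | inj₁ refl | _ = ⊥-elim (ab wj aj bk)
  ... | inj₂ refl | inj₂ refl | _ = ⊥-elim (ab wj aj bk)
  ... | inj₁ refl | inj₂ refl | inj₁ refl = ⊥-elim (ac wj aj cl)
  ... | inj₁ refl | inj₂ refl | inj₂ refl = ⊥-elim (bc wk bk cl)
  ... | inj₂ refl | inj₁ refl | inj₁ refl = ⊥-elim (bc wk bk cl)
  ... | inj₂ refl | inj₁ refl | inj₂ refl = ⊥-elim (ac wj aj cl)

  ~-some : ∀ {w R} → Unique R → 3 ≤ length R → NoCommonPoints w R → ∃[ z ] z ∈ R × z ~ w
  ~-some {R = []} _ () _
  ~-some {R = _ ∷ []} _ (s≤s ()) _
  ~-some {R = _ ∷ _ ∷ []} _ (s≤s (s≤s ())) _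
  ~-some {R = r₁ ∷ r₂ ∷ r₃ ∷ _} ((r₁≢r₂ ∷ r₁≢r₃ ∷ _) ∷ (r₂≢r₃ ∷ _) ∷ _) _ apart
    with ~-one-of-three (apart m₁ m₂ r₁≢r₂) (apart m₂ m₃ r₂≢r₃) (apart m₁ m₃ r₁≢r₃)
    where
    m₁ = here refl
    m₂ = there (here refl)
    m₃ = there (there (here refl))
  ... | inj₁ r₁~w = r₁ , here refl , r₁~w
  ... | inj₂ (inj₁ r₂~w) = r₂ , there (here refl) , r₂~w
  ... | inj₂ (inj₂ r₃~w) = r₃ , there (there (here refl)) , r₃~w

  ~-two : ∀ {w R} → Unique R → 4 ≤ length R → NoCommonPoints w R →
          ∃[ z₁ ] ∃[ z₂ ] z₁ ∈ R × z₂ ∈ R × z₁ ≢ z₂ × z₁ ~ w × z₂ ~ w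
  ~-two {w} {R} uR 4≤len apart with ~-some uR (ℕₚ.≤-trans (ℕₚ.n≤1+n 3) 4≤len) apart
  ... | z₁ , z₁∈ , z₁~w with ∈⇒↭∷ z₁∈
  ... | R′ , R↭z₁∷R′ = z₁ , z₂ , z₁∈ , from-R′ z₂∈ , z₁≢z₂ , z₁~w , z₂~w
    where
    u[z₁∷R′] = Unique-resp-↭ R↭z₁∷R′ uR
    from-R′ : R′ ⊆ R
    from-R′ r∈ = ∈-resp-↭ (↭-sym R↭z₁∷R′) (there r∈)
    second = ~-some (Unique-tail u[z₁∷R′]) (ℕₚ.≤-pred (subst (4 ≤_) (↭-length R↭z₁∷R′) 4≤len))
                    (λ r∈ r′∈ → apart (from-R′ r∈) (from-R′ r′∈))
    z₂ = proj₁ second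
    z₂∈ = proj₁ (proj₂ second)
    z₂~w = proj₂ (proj₂ second)
    z₁≢z₂ : z₁ ≢ z₂
    z₁≢z₂ z₁≡z₂ = Unique-head u[z₁∷R′] (subst (_∈ R′) (sym z₁≡z₂) z₂∈)

  outside-point⇒~both : ∀ {C t y z e} → P₃-free C → t ∈ C → y ∈ C → z ∈ C → y ~ z →
                         t ∋ e → ¬ (y ∋ e ⊎ z ∋ e) → t ~ y × t ~ z
  outside-point⇒~both {t = t} {y} {z} {e} free t∈ y∈ z∈ y~z te e∉yz with other-point t e te
  ... | f , tf , e≢f with y ∋? f
  ... | yes yf = free t∈ z∈ y∈ t≢y t~z (~-sym y~z) , t~z
    where
    t~z : t ~ z
    t~z = disjoint⇒~ λ j tj zj → [ (λ { refl → e∉yz (inj₂ zj) }) , (λ { refl → ~-disjoint y~z yf zj }) ]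
                                  (∋-distinct⇒only t te tf e≢f tj)
    t≢y : t ≢ y
    t≢y refl = e∉yz (inj₁ te)
  ... | no y∌f = t~y , free t∈ y∈ z∈ t≢z t~y y~z
    where
    t~y : t ~ y
    t~y = disjoint⇒~ λ j tj yj → [ (λ { refl → e∉yz (inj₁ yj) }) , (λ { refl → y∌f yj }) ]
                                  (∋-distinct⇒only t te tf e≢f tj)
    t≢z : t ≢ z
    t≢z refl = e∉yz (inj₂ te)

  module _ {R : List Vertex} {s₁ s₂ s₃ : Vertex} (free : P₃-free R) (k₁ : s₁ ∈ R) (k₂ : s₂ ∈ R) (k₃ : s₃ ∈ R)
           (s₁~s₂ : s₁ ~ s₂) (s₂~s₃ : s₂ ~ s₃) (s₁~s₃ : s₁ ~ s₃) where

    private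
      T : List Vertex
      T = s₁ ∷ s₂ ∷ s₃ ∷ []

      T⊆R : T ⊆ R
      T⊆R (here refl) = k₁
      T⊆R (there (here refl)) = k₂
      T⊆R (there (there (here refl))) = k₃

      ~-in-T : ∀ {s s′} → s ∈ T → s′ ∈ T → s ≢ s′ → s ~ s′
      ~-in-T (here refl) (here refl) s≢s′ = ⊥-elim (s≢s′ refl)
      ~-in-T (here refl) (there (here refl)) _ = s₁~s₂
      ~-in-T (here refl) (there (there (here refl))) _ = s₁~s₃
      ~-in-T (there (here refl)) (here refl) _ = ~-sym s₁~s₂
      ~-in-T (there (here refl)) (there (here refl)) s≢s′ = ⊥-elim (s≢s′ refl)
      ~-in-T (there (here refl)) (there (there (here refl))) _ = s₂~s₃
      ~-in-T (there (there (here refl))) (here refl) _ = ~-sym s₁~s₃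
      ~-in-T (there (there (here refl))) (there (here refl)) _ = ~-sym s₂~s₃
      ~-in-T (there (there (here refl))) (there (there (here refl))) s≢s′ = ⊥-elim (s≢s′ refl)

      ~-some-of-T : ∀ x → ∃[ s ] s ∈ T × x ~ s
      ~-some-of-T x with ~-one-of-three {x} (λ _ → ~-disjoint s₁~s₂) (λ _ → ~-disjoint s₂~s₃) (λ _ → ~-disjoint s₁~s₃)
      ... | inj₁ s₁~x = s₁ , here refl , ~-sym s₁~x
      ... | inj₂ (inj₁ s₂~x) = s₂ , there (here refl) , ~-sym s₂~x
      ... | inj₂ (inj₂ s₃~x) = s₃ , there (there (here refl)) , ~-sym s₃~x

      ~-all-of-T : ∀ {a s} → a ∈ R → s ∈ T → a ≢ s → a ~ s
      ~-all-of-T {a} {s} a∈ s∈ a≢s with ~-some-of-T a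
      ... | s′ , s′∈ , a~s′ with s′ ≟ s
      ... | yes refl = a~s′
      ... | no s′≢s = free a∈ (T⊆R s′∈) (T⊆R s∈) a≢s a~s′ (~-in-T s′∈ s∈ s′≢s)

    triangle⇒clique : Clique R
    triangle⇒clique {a} {b} a∈ b∈ a≢b with ~-some-of-T b
    ... | s , s∈ , b~s with a ≟ s
    ... | yes refl = ~-sym b~s
    ... | no a≢s = free a∈ (T⊆R s∈) b∈ a≢b (~-all-of-T a∈ s∈ a≢s) (~-sym b~s)

  shape-with-edge : ∀ {R y z} → P₃-free R → y ∈ R → z ∈ R → y ~ z → Shape R
  shape-with-edge {R} {y} {z} free y∈ z∈ y~z with find-or-refute (λ t → ¬? (Within? y z t)) R
  ... | inj₂ none = within y∈ z∈ y~z (λ {t} t∈ → decidable-stable (Within? y z t) (none t∈))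
  ... | inj₁ (t , t∈ , ¬within) with ¬Within⇒outside-point y z t ¬within
  ... | e , te , e∉yz with outside-point⇒~both free t∈ y∈ z∈ y~z te e∉yz
  ... | t~y , t~z = clique (triangle⇒clique free t∈ y∈ z∈ t~y y~z t~z)

  -- Two members meet in c; a member avoiding c would pin every member down to one of three vertices.
  independent⇒star : ∀ {R} → Unique R → 4 ≤ length R → (∀ {y z} → y ∈ R → z ∈ R → ¬ y ~ z) → ∃[ c ] Star c R
  independent⇒star {_ ∷ []} _ (s≤s ()) _
  independent⇒star {r₁ ∷ r₂ ∷ R} uR@((r₁≢r₂ ∷ _) ∷ _) 4≤len indep with ≁⇒Meet (indep (here refl) (there (here refl)))
  ... | meet c r₁c r₂c with find-or-refute (λ y → ¬? (y ∋? c)) (r₁ ∷ r₂ ∷ R)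
  ... | inj₂ none = c , λ {y} y∈ → decidable-stable (y ∋? c) (none y∈)
  ... | inj₁ (u , u∈ , u∌c) = ⊥-elim (ℕₚ.<⇒≱ 4≤len (Unique-⊆⇒length≤ uR R⊆r₁r₂u))
    where
    o₁ = other-point r₁ c r₁c
    o₂ = other-point r₂ c r₂c
    d = proj₁ o₁
    e = proj₁ o₂
    r₁d = proj₁ (proj₂ o₁)
    r₂e = proj₁ (proj₂ o₂)
    c≢d = proj₂ (proj₂ o₁)
    c≢e = proj₂ (proj₂ o₂)
    d≢e : d ≢ e
    d≢e d≡e = r₁≢r₂ (share-two⇒≡ r₁ r₂ c≢d r₁c r₁d r₂c (subst (r₂ ∋_) (sym d≡e) r₂e))
    ∋d : ∀ {t} → t ∈ r₁ ∷ r₂ ∷ R → ¬ t ∋ c → t ∋ d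
    ∋d t∈ t∌c = Meet⇒∋other t∌c r₁c r₁d c≢d (≁⇒Meet (indep t∈ (here refl)))
    ∋e : ∀ {t} → t ∈ r₁ ∷ r₂ ∷ R → ¬ t ∋ c → t ∋ e
    ∋e t∈ t∌c = Meet⇒∋other t∌c r₂c r₂e c≢e (≁⇒Meet (indep t∈ (there (here refl))))
    R⊆r₁r₂u : r₁ ∷ r₂ ∷ R ⊆ r₁ ∷ r₂ ∷ u ∷ []
    R⊆r₁r₂u {t} t∈ with t ∋? c
    ... | no t∌c = there (there (here (share-two⇒≡ t u d≢e (∋d t∈ t∌c) (∋e t∈ t∌c) (∋d u∈ u∌c) (∋e u∈ u∌c))))
    ... | yes tc with ≁⇒Meet (indep t∈ u∈)
    ... | meet j tj uj = [ (λ { refl → here (share-two⇒≡ t r₁ c≢d tc tj r₁c r₁d) })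
                         , (λ { refl → there (here (share-two⇒≡ t r₂ c≢e tc tj r₂c r₂e)) }) ]
                         (∋-distinct⇒only u (∋d u∈ u∌c) (∋e u∈ u∌c) d≢e uj)

  shape : ∀ {R} → Unique R → P₃-free R → 4 ≤ length R → Shape R
  shape {R} uR free 4≤len with find-or-refute (λ y → any? (y ~?_) R) R
  ... | inj₁ (y , y∈ , has-neighbour) with find has-neighbour
  ...   | z , z∈ , y~z = shape-with-edge free y∈ z∈ y~z
  shape {R} uR free 4≤len | inj₂ none with independent⇒star uR 4≤len (λ y∈ z∈ y~z → none y∈ (lose z∈ y~z))
  ... | c , star-c = star c star-c

  Star⇒NoCommonPoints : ∀ {w c R} → ¬ w ∋ c → Star c R → NoCommonPoints w R
  Star⇒NoCommonPoints {w} w∌c star-c {r} {r′} r∈ r′∈ r≢r′ {j} wj rj r′j =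
    r≢r′ (share-two⇒≡ r r′ (λ c≡j → w∌c (subst (w ∋_) (sym c≡j) wj)) (star-c r∈) rj (star-c r′∈) r′j)

  star-extends : ∀ {w R c} → P₃-free (w ∷ R) → Unique R → 4 ≤ length R → Star c R → w ∋ c
  star-extends {w} {R} {c} free uR 4≤len star-c = decidable-stable (w ∋? c) λ w∌c →
    let (z₁ , z₂ , z₁∈ , z₂∈ , z₁≢z₂ , z₁~w , z₂~w) = ~-two uR 4≤len (Star⇒NoCommonPoints {w} {c} {R} w∌c star-c)
    in ~-disjoint (free (there z₁∈) (here refl) (there z₂∈) z₁≢z₂ z₁~w (~-sym z₂~w)) (star-c z₁∈) (star-c z₂∈)

  clique-extends : ∀ {w R} → P₃-free (w ∷ R) → w ∉ R → Unique R → 4 ≤ length R → Clique R →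
                   ∀ {y} → y ∈ R → w ~ y
  clique-extends {w} {R} free w∉R uR 4≤len cl {y} y∈ with w ~? y
  ... | yes w~y = w~y
  ... | no w≁y with ~-two uR 4≤len (λ r∈ r′∈ r≢r′ _ → ~-disjoint (cl r∈ r′∈ r≢r′))
  ... | z₁ , z₂ , z₁∈ , z₂∈ , z₁≢z₂ , z₁~w , z₂~w with z₁ ≟ y
  ... | no z₁≢y = ⊥-elim (w≁y (free (here refl) (there z₁∈) (there y∈) (λ { refl → w∉R y∈ }) (~-sym z₁~w) (cl z₁∈ y∈ z₁≢y)))
  ... | yes refl = ⊥-elim (w≁y (free (here refl) (there z₂∈) (there y∈) (λ { refl → w∉R y∈ }) (~-sym z₂~w)
                                     (cl z₂∈ y∈ (≢-sym z₁≢z₂))))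

  Within⇒Meet : ∀ {y z t} → Within y z t → t ≢ z → Meet t y
  Within⇒Meet {y} {z} {t} t-within t≢z with Meet? t y
  ... | yes t-meets-y = t-meets-y
  ... | no ¬meet = ⊥-elim (t≢z (⊆⇒≡ t z λ {j} tj → [ (λ yj → ⊥-elim (¬meet (meet j tj yj))) , (λ zj → zj) ] (t-within j tj)))

  within-extends : ∀ {w R y z} → P₃-free (w ∷ R) → Unique R → 3 ≤ length R → y ∈ R → z ∈ R → y ~ z →
                   (∀ {t} → t ∈ R → Within y z t) → Within y z w
  within-extends {w} {R} {y} {z} free uR 3≤len y∈ z∈ y~z R-within with Within? y z w
  ... | yes w-within = w-within
  ... | no ¬within with ¬Within⇒outside-point y z w ¬within
  ... | e , we , e∉yz with outside-point⇒~both free (here refl) (there y∈) (there z∈) y~z we e∉yz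
                         | ∃-∈-∉ {R} {y ∷ z ∷ []} uR 3≤len
  ... | w~y , w~z | t , t∈ , t∉yz with Within⇒Meet {y} {z} {t} (R-within t∈) (λ t≡z → t∉yz (there (here t≡z)))
  ... | meet j tj yj = ⊥-elim (~-disjoint (free (there t∈) (here refl) (there y∈) (t∉yz ∘ here) t~w w~y) tj yj)
    where
    t~w : t ~ w
    t~w = disjoint⇒~ λ i ti wi → [ ~-disjoint w~y wi , ~-disjoint w~z wi ] (R-within t∈ i ti)

  points : List Vertex → List (Fin n)
  points [] = []
  points (b ∷ L) = pt₁ b ∷ pt₂ b ∷ points L

  length-points : ∀ L → length (points L) ≡ 2 * length L
  length-points [] = refl
  length-points (b ∷ L) = trans (cong (2 +_) (length-points L)) (sym (ℕₚ.*-suc 2 (length L)))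

  ∈points⁻ : ∀ {j L} → j ∈ points L → ∃[ b ] b ∈ L × b ∋ j
  ∈points⁻ {L = b ∷ L} (here refl) = b , here refl , ∋pt₁ b
  ∈points⁻ {L = b ∷ L} (there (here refl)) = b , here refl , ∋pt₂ b
  ∈points⁻ {L = b ∷ L} (there (there j∈)) with ∈points⁻ j∈
  ... | b′ , b′∈ , b′j = b′ , there b′∈ , b′j

  ∈points⁺ : ∀ {j b L} → b ∈ L → b ∋ j → j ∈ points L
  ∈points⁺ {b = b} (here refl) bj with ∋⇒pt b bj
  ... | inj₁ refl = here refl
  ... | inj₂ refl = there (here refl)
  ∈points⁺ (there b∈) bj = there (there (∈points⁺ b∈ bj))

  Clique⇒Unique-points : ∀ {L} → Unique L → Clique L → Unique (points L)
  Clique⇒Unique-points {[]} _ _ = []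
  Clique⇒Unique-points {b ∷ L} (b∉L ∷ uL) cl =
    (pt₁≢pt₂ b ∷ apart (∋pt₁ b)) ∷ apart (∋pt₂ b) ∷ Clique⇒Unique-points uL (λ y∈ z∈ → cl (there y∈) (there z∈))
    where
    apart : ∀ {i} → b ∋ i → All (i ≢_) (points L)
    apart bi = All.tabulate λ j∈ i≡j → let (b′ , b′∈ , b′j) = ∈points⁻ j∈ in
      ~-disjoint (cl (here refl) (there b′∈) (All.lookup b∉L b′∈)) (subst (b ∋_) i≡j bi) b′j

  clique-points-bound : ∀ {L qs} → Unique L → Clique L → points L ⊆ qs → 2 * length L ≤ length qs
  clique-points-bound {L} uL cl L⊆qs =
    subst (_≤ _) (length-points L) (Unique-⊆⇒length≤ (Clique⇒Unique-points uL cl) L⊆qs)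

  clique-covers : ∀ {B} → Unique B → Clique B → n ≤ 2 * length B → ∀ i → ∃[ b ] b ∈ B × b ∋ i
  clique-covers {B} uB cl n≤ i with DecMembership._∈?_ Finₚ._≟_ i (points B)
  ... | yes i∈ = ∈points⁻ i∈
  ... | no i∉ = ⊥-elim (ℕₚ.<-irrefl refl (ℕₚ.≤-trans 2|B|<n n≤))
    where
    2|B|<n : 2 * length B < n
    2|B|<n = subst (λ x → suc x ≤ n) (length-points B) (Unique-Fin-length≤ (∉⇒All≢ i∉ ∷ Clique⇒Unique-points uB cl))

  others : ∀ c (R : List Vertex) → Star c R → List (Fin n)
  others c [] _ = []
  others c (r ∷ R) star-c = proj₁ (other-point r c (star-c (here refl))) ∷ others c R (star-c ∘ there)

  ∈others⁻ : ∀ {c j R} (star-c : Star c R) → j ∈ others c R star-c → ∃[ r ] r ∈ R × r ∋ j × c ≢ j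
  ∈others⁻ {c} {R = r ∷ R} star-c (here refl) = r , here refl , proj₂ (other-point r c (star-c (here refl)))
  ∈others⁻ {R = r ∷ R} star-c (there j∈) with ∈others⁻ (star-c ∘ there) j∈
  ... | r′ , r′∈ , rest = r′ , there r′∈ , rest

  Star⇒Unique-others : ∀ {c R} → Unique R → (star-c : Star c R) → Unique (c ∷ others c R star-c)
  Star⇒Unique-others {c} {R} uR star-c = All.tabulate (λ j∈ → proj₂ (proj₂ (proj₂ (∈others⁻ star-c j∈)))) ∷ distinct uR star-c
    where
    distinct : ∀ {R} → Unique R → (star-c : Star c R) → Unique (others c R star-c)
    distinct {[]} _ _ = []
    distinct {r ∷ R} (r∉R ∷ uR) star-c =
      All.tabulate (λ j∈ o≡j → let (r′ , r′∈ , r′j , c≢j) = ∈others⁻ (star-c ∘ there) j∈ in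
        All.lookup r∉R r′∈ (share-two⇒≡ r r′ c≢j (star-c (here refl)) (subst (r ∋_) o≡j ro) (star-c (there r′∈)) r′j))
      ∷ distinct uR (star-c ∘ there)
      where
      ro = proj₁ (proj₂ (other-point r c (star-c (here refl))))

  length-others : ∀ c R (star-c : Star c R) → length (others c R star-c) ≡ length R
  length-others c [] _ = refl
  length-others c (r ∷ R) star-c = cong suc (length-others c R (star-c ∘ there))

  star-points-bound : ∀ {c R qs} → Unique R → Star c R → 1 ≤ length R → points R ⊆ qs → suc (length R) ≤ length qs
  star-points-bound {R = []} _ _ () _
  star-points-bound {c} {R@(r ∷ _)} {qs} uR star-c _ R⊆qs =
    subst (λ x → suc x ≤ length qs) (length-others c R star-c) (Unique-⊆⇒length≤ (Star⇒Unique-others uR star-c) c∷others⊆qs)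
    where
    c∷others⊆qs : c ∷ others c R star-c ⊆ qs
    c∷others⊆qs (here refl) = R⊆qs (∈points⁺ (here refl) (star-c (here refl)))
    c∷others⊆qs (there j∈) = let (r , r∈ , rj , _) = ∈others⁻ star-c j∈ in R⊆qs (∈points⁺ r∈ rj)

  Within-trans : ∀ {y z y′ z′ t} → Within y z y′ → Within y z z′ → Within y′ z′ t → Within y z t
  Within-trans y′-within z′-within t-within i ti = [ y′-within i , z′-within i ] (t-within i ti)

  Within⇒points⊆ : ∀ {y z R} → (∀ {t} → t ∈ R → Within y z t) → points R ⊆ points (y ∷ z ∷ [])
  Within⇒points⊆ {y} {z} R-within {j} j∈ with ∈points⁻ j∈
  ... | b , b∈ , bj = [ ∈points⁺ {L = y ∷ z ∷ []} (here refl) , ∈points⁺ {L = y ∷ z ∷ []} (there (here refl)) ] (R-within b∈ j bj)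

module UpperBound (n : ℕ) (5≤n : 5 ≤ n) where

  open PairVertices n
  open GeneralPosition n 5≤n
  open P₃FreeSets n 5≤n

  record Move (C C′ : List Vertex) : Set where
    field
      u v : Vertex
      R : List Vertex
      C↭u∷R : C ↭ u ∷ R
      C′≡v∷R : C′ ≡ v ∷ R
      u~v : u ~ v
      u∉R : u ∉ R
      v∉R : v ∉ R
      unique-R : Unique R
      free-u∷R : P₃-free (u ∷ R)
      free-v∷R : P₃-free (v ∷ R)
      gp-C′ : IsGeneralPosition K C′

    R⊆C : R ⊆ C
    R⊆C r∈ = ∈-resp-↭ (↭-sym C↭u∷R) (there r∈)

    C⊆u∷R : C ⊆ u ∷ R
    C⊆u∷R = ∈-resp-↭ C↭u∷R

    length-C : length C ≡ suc (length R)
    length-C = ↭-length C↭u∷R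

    length-C′ : length C′ ≡ length C
    length-C′ = trans (cong length C′≡v∷R) (sym length-C)

  unpack : ∀ {C C′} → IsGeneralPosition K C → LegalMove K C C′ → Move C C′
  unpack gp-C (u , v , R , C↭u∷R , refl , u∩v≡∅ , _ , gp-C′) = record
    { u = u ; v = v ; R = R ; C↭u∷R = C↭u∷R ; C′≡v∷R = refl ; u~v = adj u∩v≡∅
    ; u∉R = Unique-head u[u∷R] ; v∉R = Unique-head (proj₁ gp-C′) ; unique-R = Unique-tail (proj₁ gp-C′)
    ; free-u∷R = P₃-free-⊆ (∈-resp-↭ (↭-sym C↭u∷R)) (gp⇒P₃-free gp-C) ; free-v∷R = gp⇒P₃-free gp-C′
    ; gp-C′ = gp-C′ }
    where
    u[u∷R] = Unique-resp-↭ C↭u∷R (proj₁ gp-C)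

  vertex-set-not-P₃-free : ∀ {S} → P₃-free S → ¬ (∀ x → x ∈ S)
  vertex-set-not-P₃-free free all∈ =
    ~-disjoint (free (all∈ ca) (all∈ bd) (all∈ ce) (pair-≢ a≢e) (pair~pair c≢b c≢d a≢b a≢d) (pair~pair (≢-sym c≢b) b≢e (≢-sym c≢d) d≢e))
               (pair∋ˡ c a c≢a) (pair∋ˡ c e c≢e)
    where
    c = proj₁ (five-points 5≤n)
    open StarLeaves (proj₂ (five-points 5≤n))
    ca = pair c a c≢a
    bd = pair b d b≢d
    ce = pair c e c≢e

  covering-absorbs : ∀ {B C v} → Unique C → C ⊆ B → length B ≤ suc (length C) →
                     (∀ i → ∃[ b ] b ∈ B × b ∋ i) → (∀ {y} → y ∈ C → v ~ y) → v ∈ B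
  covering-absorbs {B} {C} {v} uC C⊆B |B|≤ covers v~C with covers (pt₁ v) | covers (pt₂ v)
  ... | b₁ , b₁∈ , b₁v | b₂ , b₂∈ , b₂v with b₁ ≟ b₂
  ... | yes refl = subst (_∈ B) (sym (share-two⇒≡ v b₁ (pt₁≢pt₂ v) (∋pt₁ v) (∋pt₂ v) b₁v b₂v)) b₁∈
  ... | no b₁≢b₂ = ⊥-elim (ℕₚ.<⇒≱ (s≤s ℕₚ.≤-refl) (ℕₚ.≤-trans (Unique-⊆⇒length≤ u[b₁b₂C] b₁b₂C⊆B) |B|≤))
    where
    b∉C : ∀ {b i} → v ∋ i → b ∋ i → b ∉ C
    b∉C vi bi b∈C = ~-disjoint (v~C b∈C) vi bi
    u[b₁b₂C] : Unique (b₁ ∷ b₂ ∷ C)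
    u[b₁b₂C] = (b₁≢b₂ ∷ ∉⇒All≢ (b∉C (∋pt₁ v) b₁v)) ∷ ∉⇒All≢ (b∉C (∋pt₂ v) b₂v) ∷ uC
    b₁b₂C⊆B : b₁ ∷ b₂ ∷ C ⊆ B
    b₁b₂C⊆B (here refl) = b₁∈
    b₁b₂C⊆B (there (here refl)) = b₂∈
    b₁b₂C⊆B (there (there y∈)) = C⊆B y∈

  module _ {k : ℕ} (5≤k : 5 ≤ k) (n≤2k+2 : n ≤ 2 * suc k) where

    Sized : (List Vertex → Set) → List Vertex → Set
    Sized P C = IsGeneralPosition K C × length C ≡ k × P C

    Preserved : (List Vertex → Set) → Set
    Preserved P = ∀ {C C′} → Sized P C → LegalMove K C C′ → P C′

    preserved-along : ∀ {P} → Preserved P → ∀ {C Cs} → Sized P C → Linked (LegalMove K) (C ∷ Cs) → All (Sized P) (C ∷ Cs)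
    preserved-along pres sized [-] = sized ∷ []
    preserved-along pres sized@(gp-C , |C|≡k , _) (move ∷ moves) =
      sized ∷ preserved-along pres (Move.gp-C′ m , trans (Move.length-C′ m) |C|≡k , pres sized move) moves
      where m = unpack gp-C move

    never-visited : ∀ {P w} → (∀ {C} → P C → w ∉ C) → ∀ {Cs} → All (Sized P) Cs → ¬ Any (w ∈_) Cs
    never-visited avoids all-sized visited = All.lookupWith {R = λ _ → ⊥} (λ (_ , _ , P-C) w∈C → avoids P-C w∈C) all-sized visited

    4≤|R| : ∀ {C C′} → length C ≡ k → (m : Move C C′) → 4 ≤ length (Move.R m)
    4≤|R| |C|≡k m = ℕₚ.≤-pred (subst (5 ≤_) (trans (sym |C|≡k) (Move.length-C m)) 5≤k)

    module CliqueCase {S C′} (gp-S : IsGeneralPosition K S) (|S|≡k : length S ≡ k) (first : LegalMove K S C′)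
                      (cl : Clique (Move.R (unpack gp-S first))) where
      open Move (unpack gp-S first)

      B : List Vertex
      B = u ∷ v ∷ R

      ~R : ∀ {x} → P₃-free (x ∷ R) → x ∉ R → ∀ {y} → y ∈ R → x ~ y
      ~R free x∉R = clique-extends free x∉R unique-R (4≤|R| |S|≡k (unpack gp-S first)) cl

      clique-B : Clique B
      clique-B (here refl) (here refl) u≢u = ⊥-elim (u≢u refl)
      clique-B (here refl) (there (here refl)) _ = u~v
      clique-B (here refl) (there (there r∈)) _ = ~R free-u∷R u∉R r∈
      clique-B (there (here refl)) (here refl) _ = ~-sym u~v
      clique-B (there (here refl)) (there (here refl)) v≢v = ⊥-elim (v≢v refl)
      clique-B (there (here refl)) (there (there r∈)) _ = ~R free-v∷R v∉R r∈
      clique-B (there (there r∈)) (here refl) _ = ~-sym (~R free-u∷R u∉R r∈)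
      clique-B (there (there r∈)) (there (here refl)) _ = ~-sym (~R free-v∷R v∉R r∈)
      clique-B (there (there r∈)) (there (there r′∈)) r≢r′ = cl r∈ r′∈ r≢r′

      unique-B : Unique B
      unique-B = (~⇒≢ u~v ∷ ∉⇒All≢ u∉R) ∷ ∉⇒All≢ v∉R ∷ unique-R

      length-B : length B ≡ suc k
      length-B = cong suc (trans (sym length-C) |S|≡k)

      covers : ∀ i → ∃[ b ] b ∈ B × b ∋ i
      covers = clique-covers unique-B clique-B (subst (λ x → n ≤ 2 * x) (sym length-B) n≤2k+2)

      preserved : Preserved (_⊆ B)
      preserved {C} (gp-C , |C|≡k , C⊆B) move = subst (_⊆ B) (sym M.C′≡v∷R) v∷R⊆B
        where
        m = unpack gp-C move
        module M = Move m
        clique-R : Clique M.R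
        clique-R a∈ b∈ = clique-B (C⊆B (M.R⊆C a∈)) (C⊆B (M.R⊆C b∈))
        v~C : ∀ {y} → y ∈ C → M.v ~ y
        v~C y∈ with M.C⊆u∷R y∈
        ... | here refl = ~-sym M.u~v
        ... | there r∈ = clique-extends M.free-v∷R M.v∉R M.unique-R (4≤|R| |C|≡k m) clique-R r∈
        v∈B : M.v ∈ B
        v∈B = covering-absorbs (proj₁ gp-C) C⊆B (ℕₚ.≤-reflexive (trans length-B (cong suc (sym |C|≡k)))) covers v~C
        v∷R⊆B : M.v ∷ M.R ⊆ B
        v∷R⊆B (here refl) = v∈B
        v∷R⊆B (there r∈) = C⊆B (M.R⊆C r∈)

      u₁≢v₁ : pt₁ u ≢ pt₁ v
      u₁≢v₁ u₁≡v₁ = ~-disjoint u~v (subst (u ∋_) u₁≡v₁ (∋pt₁ u)) (∋pt₁ v)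

      w : Vertex
      w = pair (pt₁ u) (pt₁ v) u₁≢v₁

      w∉B : w ∉ B
      w∉B w∈B with w ≟ u
      ... | yes w≡u = ~-disjoint u~v (subst (_∋ pt₁ v) w≡u (pair∋ʳ _ _ u₁≢v₁)) (∋pt₁ v)
      ... | no w≢u = ~-disjoint (clique-B w∈B (here refl) w≢u) (pair∋ˡ _ _ u₁≢v₁) (∋pt₁ u)

      initial : S ⊆ B
      initial s∈ with C⊆u∷R s∈
      ... | here refl = here refl
      ... | there r∈ = there (there r∈)

      not-mobile : ∀ {Ss} → Linked (LegalMove K) (S ∷ Ss) → ¬ (∀ x → Any (x ∈_) (S ∷ Ss))
      not-mobile moves visits =
        never-visited (λ C⊆B w∈C → w∉B (C⊆B w∈C)) (preserved-along preserved (gp-S , |S|≡k , initial) moves) (visits w)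

    module WithinCase {S C′} (gp-S : IsGeneralPosition K S) (|S|≡k : length S ≡ k) (first : LegalMove K S C′)
                      {y z} (y∈ : y ∈ Move.R (unpack gp-S first)) (z∈ : z ∈ Move.R (unpack gp-S first)) (y~z : y ~ z)
                      (R-within : ∀ {t} → t ∈ Move.R (unpack gp-S first) → Within y z t) where
      open Move (unpack gp-S first)

      AllWithin : List Vertex → Set
      AllWithin C = ∀ {t} → t ∈ C → Within y z t

      3≤|R| : ∀ {C C′} → length C ≡ k → (m : Move C C′) → 3 ≤ length (Move.R m)
      3≤|R| |C|≡k m = ℕₚ.≤-trans (ℕₚ.n≤1+n 3) (4≤|R| |C|≡k m)

      preserved : Preserved AllWithin
      preserved {C} (gp-C , |C|≡k , C-within) move = subst AllWithin (sym M.C′≡v∷R) v∷R-within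
        where
        m = unpack gp-C move
        module M = Move m
        R-points : points M.R ⊆ points (y ∷ z ∷ [])
        R-points = Within⇒points⊆ (C-within ∘ M.R⊆C)
        v-within : Within y z M.v
        v-within with shape M.unique-R (P₃-free-⊆ there M.free-v∷R) (4≤|R| |C|≡k m)
        ... | star c star-c =
          ⊥-elim (ℕₚ.<-irrefl refl (ℕₚ.≤-trans (s≤s (4≤|R| |C|≡k m))
                    (star-points-bound M.unique-R star-c (ℕₚ.≤-trans (s≤s z≤n) (4≤|R| |C|≡k m)) R-points)))
        ... | clique cl =
          ⊥-elim (ℕₚ.<⇒≱ (s≤s (s≤s (s≤s (s≤s (s≤s z≤n)))))
                    (ℕₚ.≤-trans (ℕₚ.*-monoʳ-≤ 2 (4≤|R| |C|≡k m)) (clique-points-bound M.unique-R cl R-points)))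
        ... | within {y′} {z′} y′∈ z′∈ y′~z′ R-within′ =
          Within-trans {y} {z} {y′} {z′} {M.v} (C-within (M.R⊆C y′∈)) (C-within (M.R⊆C z′∈))
                       (within-extends M.free-v∷R M.unique-R (3≤|R| |C|≡k m) y′∈ z′∈ y′~z′ R-within′)
        v∷R-within : AllWithin (M.v ∷ M.R)
        v∷R-within (here refl) = v-within
        v∷R-within (there r∈) = C-within (M.R⊆C r∈)

      e-fresh = fresh (points (y ∷ z ∷ [])) 5≤n
      e = proj₁ e-fresh

      y₁≢e : pt₁ y ≢ e
      y₁≢e y₁≡e = proj₂ e-fresh (here (sym y₁≡e))

      w : Vertex
      w = pair (pt₁ y) e y₁≢e

      avoided : ∀ {C} → AllWithin C → w ∉ C
      avoided C-within w∈C =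
        proj₂ e-fresh ([ ∈points⁺ {L = y ∷ z ∷ []} (here refl) , ∈points⁺ {L = y ∷ z ∷ []} (there (here refl)) ]
                         (C-within w∈C e (pair∋ʳ (pt₁ y) e y₁≢e)))

      initial : AllWithin S
      initial s∈ with C⊆u∷R s∈
      ... | here refl = within-extends free-u∷R unique-R (3≤|R| |S|≡k (unpack gp-S first)) y∈ z∈ y~z R-within
      ... | there r∈ = R-within r∈

      not-mobile : ∀ {Ss} → Linked (LegalMove K) (S ∷ Ss) → ¬ (∀ x → Any (x ∈_) (S ∷ Ss))
      not-mobile moves visits =
        never-visited avoided (preserved-along preserved (gp-S , |S|≡k , initial) moves) (visits w)

    no-mobile-of-size : ∀ {S} → IsMobileGeneralPosition K S → length S ≡ k → ⊥
    no-mobile-of-size (gp-S , [] , _ , visits) _ =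
      vertex-set-not-P₃-free (gp⇒P₃-free gp-S) (singleton⁻ ∘ visits)
    no-mobile-of-size (gp-S , _ ∷ _ , moves@(first ∷ _) , visits) |S|≡k
      with shape unique-R (P₃-free-⊆ there free-v∷R) (4≤|R| |S|≡k (unpack gp-S first))
      where open Move (unpack gp-S first)
    ... | star c star-c = ~-disjoint u~v (star-extends free-u∷R unique-R 4≤ star-c) (star-extends free-v∷R unique-R 4≤ star-c)
      where
      open Move (unpack gp-S first)
      4≤ = 4≤|R| |S|≡k (unpack gp-S first)
    ... | clique cl = CliqueCase.not-mobile gp-S |S|≡k first cl moves visits
    ... | within y∈ z∈ y~z R-within = WithinCase.not-mobile gp-S |S|≡k first y∈ z∈ y~z R-within moves visits

module Motions (n : ℕ) (5≤n : 5 ≤ n) where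

  open PairVertices n
  open GeneralPosition n 5≤n

  -- Configurations are lists, so besides legal moves a motion may reorder the robots.
  data Motion : List Vertex → List Vertex → Set where
    ε : ∀ {C} → Motion C C
    reorder : ∀ {C D E} → C ↭ D → Motion D E → Motion C E
    move : ∀ {C D E} → LegalMove K C D → Motion D E → Motion C E

  infixr 5 _▸_

  _▸_ : ∀ {C D E} → Motion C D → Motion D E → Motion C E
  ε ▸ q = q
  reorder C↭D p ▸ q = reorder C↭D (p ▸ q)
  move m p ▸ q = move m (p ▸ q)

  configurations : ∀ {C E} → Motion C E → List (List Vertex)
  configurations {C} ε = C ∷ []
  configurations {C} (reorder _ p) = C ∷ configurations p
  configurations {C} (move _ p) = C ∷ configurations p

  Visits : ∀ {C E} → Motion C E → Vertex → Set
  Visits p w = Any (w ∈_) (configurations p)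

  visits-start : ∀ {C E w} (p : Motion C E) → w ∈ C → Visits p w
  visits-start ε w∈ = here w∈
  visits-start (reorder _ _) w∈ = here w∈
  visits-start (move _ _) w∈ = here w∈

  visits-end : ∀ {C E w} (p : Motion C E) → w ∈ E → Visits p w
  visits-end ε w∈ = here w∈
  visits-end (reorder _ p) w∈ = there (visits-end p w∈)
  visits-end (move _ p) w∈ = there (visits-end p w∈)

  visits-▸ˡ : ∀ {C D E w} (p : Motion C D) (q : Motion D E) → Visits p w → Visits (p ▸ q) w
  visits-▸ˡ ε q (here w∈) = visits-start q w∈
  visits-▸ˡ (reorder _ p) q (here w∈) = here w∈
  visits-▸ˡ (reorder _ p) q (there v) = there (visits-▸ˡ p q v)
  visits-▸ˡ (move _ p) q (here w∈) = here w∈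
  visits-▸ˡ (move _ p) q (there v) = there (visits-▸ˡ p q v)

  visits-▸ʳ : ∀ {C D E w} (p : Motion C D) (q : Motion D E) → Visits q w → Visits (p ▸ q) w
  visits-▸ʳ ε q v = v
  visits-▸ʳ (reorder _ p) q v = there (visits-▸ʳ p q v)
  visits-▸ʳ (move _ p) q v = there (visits-▸ʳ p q v)

  gp-resp-↭ : ∀ {C D} → C ↭ D → IsGeneralPosition K C → IsGeneralPosition K D
  gp-resp-↭ C↭D gp-C = P₃-free⇒gp (Unique-resp-↭ C↭D (proj₁ gp-C)) (P₃-free-⊆ (∈-resp-↭ (↭-sym C↭D)) (gp⇒P₃-free gp-C))

  LegalMove-resp-↭ : ∀ {C₀ C D} → C₀ ↭ C → LegalMove K C D → LegalMove K C₀ D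
  LegalMove-resp-↭ C₀↭C (u , v , R , C↭u∷R , D≡v∷R , u∩v≡∅ , v∉C , gp-D) =
    u , v , R , ↭-trans C₀↭C C↭u∷R , D≡v∷R , u∩v≡∅ , v∉C ∘ ∈-resp-↭ C₀↭C , gp-D

  gp-end : ∀ {C E} → IsGeneralPosition K C → Motion C E → IsGeneralPosition K E
  gp-end gp-C ε = gp-C
  gp-end gp-C (reorder C↭D p) = gp-end (gp-resp-↭ C↭D gp-C) p
  gp-end _ (move (_ , _ , _ , _ , _ , _ , _ , gp-D) p) = gp-end gp-D p

  reverse-move : ∀ {C D} → IsGeneralPosition K C → LegalMove K C D → Motion D C
  reverse-move gp-C (u , v , R , C↭u∷R , refl , u∩v≡∅ , _ , _) =
    move (v , u , R , ↭-refl , refl , disjoint (~-sym (adj {u} {v} u∩v≡∅)) , u∉v∷R , gp-resp-↭ C↭u∷R gp-C) (reorder (↭-sym C↭u∷R) ε)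
    where
    u∉v∷R : u ∉ v ∷ R
    u∉v∷R (here u≡v) = ~⇒≢ (adj {u} {v} u∩v≡∅) u≡v
    u∉v∷R (there u∈R) = Unique-head (Unique-resp-↭ C↭u∷R (proj₁ gp-C)) u∈R

  reverse : ∀ {C E} → IsGeneralPosition K C → Motion C E → Motion E C
  reverse gp-C ε = ε
  reverse gp-C (reorder C↭D p) = reverse (gp-resp-↭ C↭D gp-C) p ▸ reorder (↭-sym C↭D) ε
  reverse gp-C (move m p) = reverse (gp-end gp-C (move m ε)) p ▸ reverse-move gp-C m

  linearise : ∀ {C₀ C E} → C₀ ↭ C → (p : Motion C E) →
              ∃[ Cs ] Linked (LegalMove K) (C₀ ∷ Cs) × (∀ {w} → Visits p w → Any (w ∈_) (C₀ ∷ Cs))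
  linearise C₀↭C ε = [] , [-] , λ { (here w∈) → here (∈-resp-↭ (↭-sym C₀↭C) w∈) }
  linearise C₀↭C (reorder C↭D p) with linearise (↭-trans C₀↭C C↭D) p
  ... | Cs , moves , visits = Cs , moves , λ { (here w∈) → here (∈-resp-↭ (↭-sym C₀↭C) w∈) ; (there v) → visits v }
  linearise C₀↭C (move {D = D} m p) with linearise {D} ↭-refl p
  ... | Cs , moves , visits =
    D ∷ Cs , LegalMove-resp-↭ C₀↭C m ∷ moves , λ { (here w∈) → here (∈-resp-↭ (↭-sym C₀↭C) w∈) ; (there v) → there (visits v) }

  pairs-with : Fin n → Fin n → List Vertex
  pairs-with i j with i Finₚ.≟ j
  ... | yes _ = []
  ... | no i≢j = pair i j i≢j ∷ []

  row : Fin n → List Vertex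
  row i = concatMap (pairs-with i) (allFin n)

  allVertices : List Vertex
  allVertices = concatMap row (allFin n)

  ∈allVertices : ∀ v → v ∈ allVertices
  ∈allVertices v = subst (_∈ allVertices) (sym (pair-pts v))
    (∈ₚ.∈-concatMap⁺ row (lose (∈ₚ.∈-allFin (pt₁ v)) (∈ₚ.∈-concatMap⁺ (pairs-with (pt₁ v)) (lose (∈ₚ.∈-allFin (pt₂ v)) ∈pairs-with))))
    where
    ∈pairs-with : pair (pt₁ v) (pt₂ v) (pt₁≢pt₂ v) ∈ pairs-with (pt₁ v) (pt₂ v)
    ∈pairs-with with pt₁ v Finₚ.≟ pt₂ v
    ... | yes pt₁≡pt₂ = ⊥-elim (pt₁≢pt₂ v pt₁≡pt₂)
    ... | no _ = here (vertex-≡ _ _ refl)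

  ReachesPair : List Vertex → Fin n → Fin n → Set
  ReachesPair S s t = ∃[ C ] Motion S C × ∃[ y ] y ∈ C × y ∋ s × y ∋ t

  ReachesPair-sym : ∀ {S s t} → ReachesPair S t s → ReachesPair S s t
  ReachesPair-sym (C , p , y , y∈ , yt , ys) = C , p , y , y∈ , ys , yt

  infixr 4 _◂_

  _◂_ : ∀ {S S′ s t} → Motion S S′ → ReachesPair S′ s t → ReachesPair S s t
  p ◂ (C , q , rest) = C , p ▸ q , rest

  -- Tour every vertex and come back each time; reversibility of moves makes this a single motion.
  reaches-pairs⇒mobile : ∀ {S} → IsGeneralPosition K S → (∀ {s t} → s ≢ t → ReachesPair S s t) → IsMobileGeneralPosition K S
  reaches-pairs⇒mobile {S} gp-S reaches = gp-S , proj₁ tour , proj₁ (proj₂ tour) , λ x → proj₂ (proj₂ tour) (tour-visits x (∈allVertices x))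
    where
    go : ∀ w → Motion S _
    go w = proj₁ (proj₂ (reaches (pt₁≢pt₂ w)))
    loop : List Vertex → Motion S S
    loop [] = ε
    loop (w ∷ ws) = go w ▸ reverse gp-S (go w) ▸ loop ws
    go-visits : ∀ w → Visits (go w) w
    go-visits w with reaches (pt₁≢pt₂ w)
    ... | C , p , y , y∈ , y₁ , y₂ = visits-end p (subst (_∈ C) (share-two⇒≡ y w (pt₁≢pt₂ w) y₁ y₂ (∋pt₁ w) (∋pt₂ w)) y∈)
    tour-visits : ∀ x {ws} → x ∈ ws → Visits (loop ws) x
    tour-visits x {w ∷ ws} (here refl) = visits-▸ˡ (go w) _ (go-visits w)
    tour-visits x {w ∷ ws} (there x∈) = visits-▸ʳ (go w) _ (visits-▸ʳ (reverse gp-S (go w)) (loop ws) (tour-visits x x∈))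
    tour = linearise ↭-refl (loop allVertices)

module StarMobile (n : ℕ) (5≤n : 5 ≤ n) where

  open PairVertices n
  open GeneralPosition n 5≤n
  open P₃FreeSets n 5≤n using (Star)
  open Motions n 5≤n

  legal-move : ∀ {x v R} → x ~ v → v ∉ x ∷ R → IsGeneralPosition K (v ∷ R) → LegalMove K (x ∷ R) (v ∷ R)
  legal-move {x} {v} {R} x~v v∉ gp = x , v , R , ↭-refl , refl , disjoint x~v , v∉ , gp

  Star⇒P₃-free : ∀ {c C} → Star c C → P₃-free C
  Star⇒P₃-free star-c u∈ m∈ _ _ u~m _ = ⊥-elim (~-disjoint u~m (star-c u∈) (star-c m∈))

  ∌⇒∉Star : ∀ {c v C} → ¬ v ∋ c → Star c C → v ∉ C
  ∌⇒∉Star v∌c star-c v∈ = v∌c (star-c v∈)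

  pendant-P₃-free : ∀ {c X Ys} → Star c Ys → (∀ {y y′} → y ∈ Ys → y′ ∈ Ys → X ~ y → X ~ y′ → y ≡ y′) →
                    P₃-free (X ∷ Ys)
  pendant-P₃-free star-c one (here refl) (here refl) _ _ X~X _ = ⊥-elim (~-irrefl X~X)
  pendant-P₃-free star-c one (there _) (here refl) (here refl) _ _ X~X = ⊥-elim (~-irrefl X~X)
  pendant-P₃-free star-c one (there u∈) (here refl) (there w∈) u≢w u~X X~w = ⊥-elim (u≢w (one u∈ w∈ (~-sym u~X) X~w))
  pendant-P₃-free star-c one (here refl) (there _) (here refl) X≢X _ _ = ⊥-elim (X≢X refl)
  pendant-P₃-free star-c one (here refl) (there m∈) (there w∈) _ _ m~w = ⊥-elim (~-disjoint m~w (star-c m∈) (star-c w∈))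
  pendant-P₃-free star-c one (there u∈) (there m∈) _ _ u~m _ = ⊥-elim (~-disjoint u~m (star-c u∈) (star-c m∈))

  -- The vertex pq meets cp and cq, so it sees only cr.
  pendant-gp : ∀ {c p q r} (c≢p : c ≢ p) (c≢q : c ≢ q) (c≢r : c ≢ r) (p≢q : p ≢ q) (p≢r : p ≢ r) (q≢r : q ≢ r) →
               IsGeneralPosition K (pair p q p≢q ∷ pair c p c≢p ∷ pair c q c≢q ∷ pair c r c≢r ∷ [])
  pendant-gp {c} {p} {q} {r} c≢p c≢q c≢r p≢q p≢r q≢r =
    P₃-free⇒gp ((∉⇒All≢ (∌⇒∉Star pq∌c star-c) ∷ (pair-≢ p≢q ∷ pair-≢ p≢r ∷ []) ∷ (pair-≢ q≢r ∷ []) ∷ [] ∷ []))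
               (pendant-P₃-free star-c λ y∈ y′∈ pq~y pq~y′ → trans (only-r y∈ pq~y) (sym (only-r y′∈ pq~y′)))
    where
    pq∌c = pair∌ {a≢b = p≢q} c≢p c≢q
    star-c : Star c (pair c p c≢p ∷ pair c q c≢q ∷ pair c r c≢r ∷ [])
    star-c (here refl) = pair∋ˡ c p c≢p
    star-c (there (here refl)) = pair∋ˡ c q c≢q
    star-c (there (there (here refl))) = pair∋ˡ c r c≢r
    only-r : ∀ {y} → y ∈ pair c p c≢p ∷ pair c q c≢q ∷ pair c r c≢r ∷ [] → pair p q p≢q ~ y → y ≡ pair c r c≢r
    only-r (here refl) pq~cp = ⊥-elim (~-disjoint pq~cp (pair∋ˡ p q p≢q) (pair∋ʳ c p c≢p))
    only-r (there (here refl)) pq~cq = ⊥-elim (~-disjoint pq~cq (pair∋ʳ p q p≢q) (pair∋ʳ c q c≢q))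
    only-r (there (there (here refl))) _ = refl

  module _ {c : Fin n} where

    St : StarLeaves c → List Vertex
    St L = pair c a c≢a ∷ pair c b c≢b ∷ pair c d c≢d ∷ pair c e c≢e ∷ []
      where open StarLeaves L

    leaves : StarLeaves c → List (Fin n)
    leaves L = a ∷ b ∷ d ∷ e ∷ []
      where open StarLeaves L

    St-star : ∀ L → Star c (St L)
    St-star L (here refl) = pair∋ˡ c _ (StarLeaves.c≢a L)
    St-star L (there (here refl)) = pair∋ˡ c _ (StarLeaves.c≢b L)
    St-star L (there (there (here refl))) = pair∋ˡ c _ (StarLeaves.c≢d L)
    St-star L (there (there (there (here refl)))) = pair∋ˡ c _ (StarLeaves.c≢e L)

    St-gp : ∀ L → IsGeneralPosition K (St L)
    St-gp L = P₃-free⇒gp ((pair-≢ a≢b ∷ pair-≢ a≢d ∷ pair-≢ a≢e ∷ []) ∷ (pair-≢ b≢d ∷ pair-≢ b≢e ∷ []) ∷ (pair-≢ d≢e ∷ []) ∷ [] ∷ [])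
                         (Star⇒P₃-free (St-star L))
      where open StarLeaves L

    ray : ∀ {x L} (c≢x : c ≢ x) → pair c x c≢x ∈ St L → ∃[ y ] y ∈ St L × y ∋ c × y ∋ x
    ray {x} c≢x y∈ = pair c x c≢x , y∈ , pair∋ˡ c x c≢x , pair∋ʳ c x c≢x

    leaf-vertex : ∀ L {x} → x ∈ leaves L → ∃[ y ] y ∈ St L × y ∋ c × y ∋ x
    leaf-vertex L (here refl) = ray {L = L} (StarLeaves.c≢a L) (here refl)
    leaf-vertex L (there (here refl)) = ray {L = L} (StarLeaves.c≢b L) (there (here refl))
    leaf-vertex L (there (there (here refl))) = ray {L = L} (StarLeaves.c≢d L) (there (there (here refl)))
    leaf-vertex L (there (there (there (here refl)))) = ray {L = L} (StarLeaves.c≢e L) (there (there (there (here refl))))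


    swap-ab swap-bd swap-de : StarLeaves c → StarLeaves c
    swap-ab L = record
      { a = b ; b = a ; d = d ; e = e ; c≢a = c≢b ; c≢b = c≢a ; c≢d = c≢d ; c≢e = c≢e
      ; a≢b = ≢-sym a≢b ; a≢d = b≢d ; a≢e = b≢e ; b≢d = a≢d ; b≢e = a≢e ; d≢e = d≢e }
      where open StarLeaves L
    swap-bd L = record
      { a = a ; b = d ; d = b ; e = e ; c≢a = c≢a ; c≢b = c≢d ; c≢d = c≢b ; c≢e = c≢e
      ; a≢b = a≢d ; a≢d = a≢b ; a≢e = a≢e ; b≢d = ≢-sym b≢d ; b≢e = d≢e ; d≢e = b≢e }
      where open StarLeaves L
    swap-de L = record
      { a = a ; b = b ; d = e ; e = d ; c≢a = c≢a ; c≢b = c≢b ; c≢d = c≢e ; c≢e = c≢d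
      ; a≢b = a≢b ; a≢d = a≢e ; a≢e = a≢d ; b≢d = b≢e ; b≢e = b≢d ; d≢e = ≢-sym d≢e }
      where open StarLeaves L

    swap-ab-motion : ∀ L → Motion (St L) (St (swap-ab L))
    swap-ab-motion L = reorder (swap _ _ ↭-refl) ε

    swap-bd-motion : ∀ L → Motion (St L) (St (swap-bd L))
    swap-bd-motion L = reorder (prep _ (swap _ _ ↭-refl)) ε

    swap-de-motion : ∀ L → Motion (St L) (St (swap-de L))
    swap-de-motion L = reorder (prep _ (prep _ (swap _ _ ↭-refl))) ε

    swap-ab-leaves : ∀ L → leaves L ⊆ leaves (swap-ab L)
    swap-ab-leaves L = ∈-resp-↭ (swap _ _ ↭-refl)

    swap-bd-leaves : ∀ L → leaves L ⊆ leaves (swap-bd L)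
    swap-bd-leaves L = ∈-resp-↭ (prep _ (swap _ _ ↭-refl))

    swap-de-leaves : ∀ L → leaves L ⊆ leaves (swap-de L)
    swap-de-leaves L = ∈-resp-↭ (prep _ (prep _ (swap _ _ ↭-refl)))

    replace-a : ∀ L p → c ≢ p → p ≢ StarLeaves.b L → p ≢ StarLeaves.d L → p ≢ StarLeaves.e L → StarLeaves c
    replace-a L p c≢p p≢b p≢d p≢e = record L { a = p ; c≢a = c≢p ; a≢b = p≢b ; a≢d = p≢d ; a≢e = p≢e }

    -- The robot on ca detours through bd, which sees only ce.
    replace-a-motion : ∀ L p c≢p p≢b p≢d p≢e → Motion (St L) (St (replace-a L p c≢p p≢b p≢d p≢e))
    replace-a-motion L p c≢p p≢b p≢d p≢e =
      move (legal-move ca~bd bd∉St (pendant-gp c≢b c≢d c≢e b≢d b≢e d≢e)) (move (legal-move bd~cp cp∉ (St-gp (replace-a L p c≢p p≢b p≢d p≢e))) ε)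
      where
      open StarLeaves L
      bd∌c : ¬ pair b d b≢d ∋ c
      bd∌c = pair∌ {a≢b = b≢d} c≢b c≢d
      ca~bd : pair c a c≢a ~ pair b d b≢d
      ca~bd = pair~pair c≢b c≢d a≢b a≢d
      bd∉St : pair b d b≢d ∉ St L
      bd∉St = ∌⇒∉Star bd∌c (St-star L)
      bd~cp : pair b d b≢d ~ pair c p c≢p
      bd~cp = pair~pair (≢-sym c≢b) (≢-sym p≢b) (≢-sym c≢d) (≢-sym p≢d)
      cp∉ : pair c p c≢p ∉ pair b d b≢d ∷ pair c b c≢b ∷ pair c d c≢d ∷ pair c e c≢e ∷ []
      cp∉ (here cp≡bd) = bd∌c (subst (_∋ c) cp≡bd (pair∋ˡ c p c≢p))
      cp∉ (there (here cp≡cb)) = pair-≢ p≢b cp≡cb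
      cp∉ (there (there (here cp≡cd))) = pair-≢ p≢d cp≡cd
      cp∉ (there (there (there (here cp≡ce)))) = pair-≢ p≢e cp≡ce

    -- The robot on cd jumps to ab, which sees only ce.
    reaches-ab : ∀ L → ReachesPair (St L) (StarLeaves.a L) (StarLeaves.b L)
    reaches-ab L = _ , reorder cd-first (move (legal-move cd~ab ab∉ (pendant-gp c≢a c≢b c≢e a≢b a≢e b≢e)) ε)
                 , pair a b a≢b , here refl , pair∋ˡ a b a≢b , pair∋ʳ a b a≢b
      where
      open StarLeaves L
      cd-first : St L ↭ pair c d c≢d ∷ pair c a c≢a ∷ pair c b c≢b ∷ pair c e c≢e ∷ []
      cd-first = ↭-trans (prep _ (swap _ _ ↭-refl)) (swap _ _ ↭-refl)
      cd~ab : pair c d c≢d ~ pair a b a≢b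
      cd~ab = pair~pair c≢a c≢b (≢-sym a≢d) (≢-sym b≢d)
      ab∉ : pair a b a≢b ∉ pair c d c≢d ∷ pair c a c≢a ∷ pair c b c≢b ∷ pair c e c≢e ∷ []
      ab∉ = ∌⇒∉Star (pair∌ {a≢b = a≢b} c≢a c≢b) (St-star L ∘ ∈-resp-↭ (↭-sym cd-first))

    make-leaf : ∀ L x → c ≢ x → ∀ z → z ≢ x →
                ∃[ L′ ] Motion (St L) (St L′) × x ∈ leaves L′ × (z ∈ leaves L → z ∈ leaves L′)
    make-leaf L x c≢x z z≢x with DecMembership._∈?_ Finₚ._≟_ x (leaves L)
    ... | yes x∈ = L , ε , x∈ , id
    ... | no x∉ with StarLeaves.a L Finₚ.≟ z
    ... | no a≢z = replace-a L x c≢x x≢b x≢d x≢e , replace-a-motion L x c≢x x≢b x≢d x≢e , here refl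
                 , λ { (here z≡a) → ⊥-elim (a≢z (sym z≡a)) ; (there z∈) → there z∈ }
      where
      x≢b = λ x≡b → x∉ (there (here x≡b))
      x≢d = λ x≡d → x∉ (there (there (here x≡d)))
      x≢e = λ x≡e → x∉ (there (there (there (here x≡e))))
    ... | yes a≡z = replace-a (swap-ab L) x c≢x x≢a x≢d x≢e
                  , swap-ab-motion L ▸ replace-a-motion (swap-ab L) x c≢x x≢a x≢d x≢e , here refl
                  , λ _ → there (here (sym a≡z))
      where
      x≢a = λ x≡a → x∉ (here x≡a)
      x≢d = λ x≡d → x∉ (there (there (here x≡d)))
      x≢e = λ x≡e → x∉ (there (there (there (here x≡e))))

    to-front : ∀ L {x} → x ∈ leaves L →
               ∃[ L′ ] Motion (St L) (St L′) × StarLeaves.a L′ ≡ x × leaves L ⊆ leaves L′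
    to-front L (here refl) = L , ε , refl , id
    to-front L (there (here refl)) = swap-ab L , swap-ab-motion L , refl , swap-ab-leaves L
    to-front L (there (there (here refl))) =
      swap-ab (swap-bd L) , swap-bd-motion L ▸ swap-ab-motion (swap-bd L) , refl , swap-ab-leaves (swap-bd L) ∘ swap-bd-leaves L
    to-front L (there (there (there (here refl)))) =
      swap-ab (swap-bd (swap-de L)) , swap-de-motion L ▸ swap-bd-motion (swap-de L) ▸ swap-ab-motion (swap-bd (swap-de L)) , refl
      , swap-ab-leaves (swap-bd (swap-de L)) ∘ swap-bd-leaves (swap-de L) ∘ swap-de-leaves L

    to-second : ∀ L {x} → x ∈ leaves L → x ≢ StarLeaves.a L →
                ∃[ L′ ] Motion (St L) (St L′) × StarLeaves.a L′ ≡ StarLeaves.a L × StarLeaves.b L′ ≡ x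
    to-second L (here refl) x≢a = ⊥-elim (x≢a refl)
    to-second L (there (here refl)) _ = L , ε , refl , refl
    to-second L (there (there (here refl))) _ = swap-bd L , swap-bd-motion L , refl , refl
    to-second L (there (there (there (here refl)))) _ =
      swap-bd (swap-de L) , swap-de-motion L ▸ swap-bd-motion (swap-de L) , refl , refl

    reaches-center : ∀ L {t} → c ≢ t → ReachesPair (St L) c t
    reaches-center L {t} c≢t with make-leaf L t c≢t c c≢t
    ... | L′ , p , t∈ , _ = p ◂ (St L′ , ε , leaf-vertex L′ t∈)

    reaches-off-center : ∀ L {s t} → c ≢ s → c ≢ t → s ≢ t → ReachesPair (St L) s t
    reaches-off-center L {s} {t} c≢s c≢t s≢t with make-leaf L s c≢s t (≢-sym s≢t)
    ... | L₁ , p₁ , s∈₁ , _ with make-leaf L₁ t c≢t s s≢t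
    ... | L₂ , p₂ , t∈₂ , keeps-s with to-front L₂ (keeps-s s∈₁)
    ... | L₃ , p₃ , a₃≡s , L₂⊆L₃ with to-second L₃ (L₂⊆L₃ t∈₂) (λ t≡a₃ → s≢t (trans (sym a₃≡s) (sym t≡a₃)))
    ... | L₄ , p₄ , a₄≡a₃ , b₄≡t =
      p₁ ◂ p₂ ◂ p₃ ◂ p₄ ◂ subst₂ (ReachesPair (St L₄)) (trans a₄≡a₃ a₃≡s) b₄≡t (reaches-ab L₄)

    star-reaches : ∀ L {s t} → s ≢ t → ReachesPair (St L) s t
    star-reaches L {s} {t} s≢t with s Finₚ.≟ c | t Finₚ.≟ c
    ... | yes refl | _ = reaches-center L s≢t
    ... | no _ | yes refl = ReachesPair-sym (reaches-center L (≢-sym s≢t))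
    ... | no s≢c | no t≢c = reaches-off-center L (≢-sym s≢c) (≢-sym t≢c) s≢t

  star-mobile : ∃[ S ] IsMobileGeneralPosition K S × length S ≡ 4
  star-mobile = St L , reaches-pairs⇒mobile (St-gp L) (star-reaches L) , refl
    where
    L = proj₂ (five-points 5≤n)

module CliqueMobile (n : ℕ) (5≤n : 5 ≤ n) where

  open PairVertices n
  open GeneralPosition n 5≤n
  open P₃FreeSets n 5≤n using (Clique; points; length-points; ∈points⁻; ∈points⁺)
  open Motions n 5≤n
  open StarMobile n 5≤n using (legal-move)

  CliqueConfig : List Vertex → Set
  CliqueConfig C = Unique C × Clique C

  CliqueConfig⇒gp : ∀ {C} → CliqueConfig C → IsGeneralPosition K C
  CliqueConfig⇒gp (uC , cl) = P₃-free⇒gp uC λ u∈ _ w∈ u≢w _ _ → cl u∈ w∈ u≢w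

  Covered : List Vertex → Fin n → Set
  Covered C i = ∃[ b ] b ∈ C × b ∋ i

  Covered? : ∀ C i → Dec (Covered C i)
  Covered? C i with DecMembership._∈?_ Finₚ._≟_ i (points C)
  ... | yes i∈ = yes (∈points⁻ i∈)
  ... | no i∉ = no λ (b , b∈ , bi) → i∉ (∈points⁺ b∈ bi)

  Uncovered : List Vertex → Vertex → Set
  Uncovered C v = ∀ {i} → v ∋ i → ¬ Covered C i

  Uncovered⇒~ : ∀ {C v y} → Uncovered C v → y ∈ C → v ~ y
  Uncovered⇒~ {y = y} v-free y∈ = disjoint⇒~ λ i vi yi → v-free vi (y , y∈ , yi)

  Uncovered⇒∉ : ∀ {C v} → Uncovered C v → v ∉ C
  Uncovered⇒∉ {v = v} v-free v∈ = v-free (∋pt₁ v) (v , v∈ , ∋pt₁ v)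

  Uncovered-pair : ∀ {C f g} (f≢g : f ≢ g) → ¬ Covered C f → ¬ Covered C g → Uncovered C (pair f g f≢g)
  Uncovered-pair {f = f} {g} f≢g f-free g-free i∈ = [ (λ { refl → f-free }) , (λ { refl → g-free }) ] (pair∋⇒ f g f≢g i∈)

  CliqueConfig-∷ : ∀ {C v} → CliqueConfig C → Uncovered C v → CliqueConfig (v ∷ C)
  CliqueConfig-∷ {v = v} (uC , cl) v-free = (∉⇒All≢ (Uncovered⇒∉ v-free) ∷ uC) , cl′
    where
    cl′ : Clique (v ∷ _)
    cl′ (here refl) (here refl) v≢v = ⊥-elim (v≢v refl)
    cl′ (here refl) (there z∈) _ = Uncovered⇒~ v-free z∈
    cl′ (there y∈) (here refl) _ = ~-sym (Uncovered⇒~ v-free y∈)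
    cl′ (there y∈) (there z∈) y≢z = cl y∈ z∈ y≢z

  fresh-uncovered : ∀ C (L : List (Fin n)) → 2 * length C + length L < n → ∃[ d ] ¬ Covered C d × d ∉ L
  fresh-uncovered C L len< with fresh (points C ++ L) (subst (_< n) (sym length-points++L) len<)
    where
    length-points++L : length (points C ++ L) ≡ 2 * length C + length L
    length-points++L = trans (Listₚ.length-++ (points C)) (cong (_+ length L) (length-points C))
  ... | d , d∉ = d , (λ (b , b∈ , bd) → d∉ (∈ₚ.∈-++⁺ˡ (∈points⁺ b∈ bd))) , (λ d∈L → d∉ (∈ₚ.∈-++⁺ʳ (points C) d∈L))

  record Jump (C : List Vertex) (X : Vertex) {f g : Fin n} (f≢g : f ≢ g) : Set where
    field
      C′ : List Vertex
      motion : Motion C C′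
      clique-C′ : CliqueConfig C′
      length-C′ : length C′ ≡ length C
      target∈ : pair f g f≢g ∈ C′
      covered-C′ : ∀ {i} → Covered C′ i → i ≡ f ⊎ i ≡ g ⊎ (Covered C i × ¬ X ∋ i)

  jump : ∀ {C X f g} → CliqueConfig C → X ∈ C → (f≢g : f ≢ g) → ¬ Covered C f → ¬ Covered C g → Jump C X f≢g
  jump {C} {X} {f} {g} (uC , cl) X∈ f≢g f-free g-free = record
    { C′ = v ∷ R
    ; motion = reorder C↭X∷R (move (legal-move (~-sym (v~C (here refl))) v∉X∷R (CliqueConfig⇒gp clique-v∷R)) ε)
    ; clique-C′ = clique-v∷R
    ; length-C′ = sym (↭-length C↭X∷R)
    ; target∈ = here refl
    ; covered-C′ = covered
    }
    where
    v = pair f g f≢g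
    R = proj₁ (∈⇒↭∷ X∈)
    C↭X∷R = proj₂ (∈⇒↭∷ X∈)
    X∷R⊆C : X ∷ R ⊆ C
    X∷R⊆C = ∈-resp-↭ (↭-sym C↭X∷R)
    u[X∷R] = Unique-resp-↭ C↭X∷R uC
    v-free : Uncovered C v
    v-free = Uncovered-pair f≢g f-free g-free
    v~C : ∀ {y} → y ∈ X ∷ R → v ~ y
    v~C = Uncovered⇒~ v-free ∘ X∷R⊆C
    v∉X∷R : v ∉ X ∷ R
    v∉X∷R = Uncovered⇒∉ v-free ∘ X∷R⊆C
    clique-v∷R : CliqueConfig (v ∷ R)
    clique-v∷R = CliqueConfig-∷ (Unique-tail u[X∷R] , λ y∈ z∈ → cl (X∷R⊆C (there y∈)) (X∷R⊆C (there z∈)))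
                                (λ vi (b , b∈ , bi) → v-free vi (b , X∷R⊆C (there b∈) , bi))
    covered : ∀ {i} → Covered (v ∷ R) i → i ≡ f ⊎ i ≡ g ⊎ (Covered C i × ¬ X ∋ i)
    covered (_ , here refl , vi) = Sum.map id inj₁ (pair∋⇒ f g f≢g vi)
    covered (b , there b∈ , bi) = inj₂ (inj₂ ((b , X∷R⊆C (there b∈) , bi) , λ Xi →
      ~-disjoint (cl (X∷R⊆C (here refl)) (X∷R⊆C (there b∈)) (λ X≡b → Unique-head u[X∷R] (subst (_∈ R) (sym X≡b) b∈))) Xi bi))

  module _ {m : ℕ} (2m+3≤n : 2 * m + 3 ≤ n) where

    room : ∀ (C : List Vertex) (L : List (Fin n)) → length C ≤ m → length L ≤ 2 → 2 * length C + length L < n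
    room _ _ |C|≤m |L|≤2 = ℕₚ.≤-trans (s≤s (ℕₚ.+-mono-≤ (ℕₚ.*-monoʳ-≤ 2 |C|≤m) |L|≤2))
                                  (ℕₚ.≤-trans (ℕₚ.≤-reflexive (sym (ℕₚ.+-suc (2 * m) 2))) 2m+3≤n)

    -- The robot covering s jumps to two uncovered points, chosen to avoid t as well.
    uncover : ∀ {C} → CliqueConfig C → length C ≡ m → ∀ s t →
              ∃[ C′ ] Motion C C′ × CliqueConfig C′ × length C′ ≡ m × ¬ Covered C′ s × (¬ Covered C t → ¬ Covered C′ t)
    uncover {C} clique-C |C|≡m s t with Covered? C s
    ... | no s-free = C , ε , clique-C , |C|≡m , s-free , id
    ... | yes s-covered@(X , X∈ , Xs) =
      Jump.C′ jumped , Jump.motion jumped , Jump.clique-C′ jumped , trans (Jump.length-C′ jumped) |C|≡m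
      , (λ cov → [ (λ s≡f → f-free (subst (Covered C) s≡f s-covered))
                 , [ (λ s≡g → g-free (subst (Covered C) s≡g s-covered)) , (λ (_ , X∌s) → X∌s Xs) ] ]
                   (Jump.covered-C′ jumped cov))
      , (λ t-free cov → [ (λ t≡f → f∉ (here (sym t≡f))) , [ (λ t≡g → g∉ (there (here (sym t≡g)))) , t-free ∘ proj₁ ] ]
                          (Jump.covered-C′ jumped cov))
      where
      |C|≤m = ℕₚ.≤-reflexive |C|≡m
      F = fresh-uncovered C (t ∷ []) (room C (t ∷ []) |C|≤m (s≤s z≤n))
      f = proj₁ F
      f-free = proj₁ (proj₂ F)
      f∉ = proj₂ (proj₂ F)
      G = fresh-uncovered C (f ∷ t ∷ []) (room C (f ∷ t ∷ []) |C|≤m (s≤s (s≤s z≤n)))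
      g = proj₁ G
      g-free = proj₁ (proj₂ G)
      g∉ = proj₂ (proj₂ G)
      f≢g : f ≢ g
      f≢g f≡g = g∉ (here (sym f≡g))
      jumped = jump clique-C X∈ f≢g f-free g-free

    clique-reaches : ∀ {C} → CliqueConfig C → length C ≡ m → 1 ≤ m → ∀ {s t} → s ≢ t → ReachesPair C s t
    clique-reaches clique-C |C|≡m 1≤m {s} {t} s≢t with uncover clique-C |C|≡m s t
    ... | C₁ , p₁ , clique-C₁ , |C₁|≡m , s-free₁ , _ with uncover clique-C₁ |C₁|≡m t s
    ... | C₂@(X ∷ _) , p₂ , clique-C₂ , |C₂|≡m , t-free₂ , keeps-s-free =
      Jump.C′ jumped , p₁ ▸ p₂ ▸ Jump.motion jumped , pair s t s≢t , Jump.target∈ jumped , pair∋ˡ s t s≢t , pair∋ʳ s t s≢t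
      where jumped = jump clique-C₂ (here refl) s≢t (keeps-s-free s-free₁) t-free₂
    ... | [] , _ , _ , |C₂|≡m , _ = ⊥-elim (ℕₚ.<-irrefl |C₂|≡m 1≤m)

    clique-of-size : ∀ j → j ≤ m → ∃[ C ] CliqueConfig C × length C ≡ j
    clique-of-size zero _ = [] , ([] , λ ()) , refl
    clique-of-size (suc j) j<m with clique-of-size j (ℕₚ.≤-trans (ℕₚ.n≤1+n j) j<m)
    ... | C , clique-C , |C|≡j = pair f g f≢g ∷ C , CliqueConfig-∷ clique-C (Uncovered-pair f≢g f-free g-free) , cong suc |C|≡j
      where
      |C|≤m = ℕₚ.≤-trans (ℕₚ.≤-reflexive |C|≡j) (ℕₚ.≤-trans (ℕₚ.n≤1+n j) j<m)
      F = fresh-uncovered C [] (room C [] |C|≤m z≤n)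
      f = proj₁ F
      f-free = proj₁ (proj₂ F)
      G = fresh-uncovered C (f ∷ []) (room C (f ∷ []) |C|≤m (s≤s z≤n))
      g = proj₁ G
      g-free = proj₁ (proj₂ G)
      f≢g : f ≢ g
      f≢g f≡g = proj₂ (proj₂ G) (here (sym f≡g))

    clique-mobile : 1 ≤ m → ∃[ S ] IsMobileGeneralPosition K S × length S ≡ m
    clique-mobile 1≤m with clique-of-size m ℕₚ.≤-refl
    ... | C , clique-C , |C|≡m = C , reaches-pairs⇒mobile (CliqueConfig⇒gp clique-C) (clique-reaches clique-C |C|≡m 1≤m) , |C|≡m

module _ (m : ℕ) (3≤m : 3 ≤ m) where

  private
    x = m ∸ 3

    m≡3+x : m ≡ 3 + x
    m≡3+x = sym (ℕₚ.m+[n∸m]≡n 3≤m)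

  2*[m∸3]/2+3≤m : 2 * (x / 2) + 3 ≤ m
  2*[m∸3]/2+3≤m = begin
    2 * (x / 2) + 3 ≡⟨ ℕₚ.+-comm (2 * (x / 2)) 3 ⟩
    3 + 2 * (x / 2) ≡⟨ cong (3 +_) (ℕₚ.*-comm 2 (x / 2)) ⟩
    3 + x / 2 * 2   ≤⟨ ℕₚ.+-monoʳ-≤ 3 (m/n*n≤m x 2) ⟩
    3 + x           ≡⟨ sym m≡3+x ⟩
    m               ∎
    where open ℕₚ.≤-Reasoning

  [m∸3]/2<k⇒m≤2[1+k] : ∀ {k} → x / 2 < k → m ≤ 2 * suc k
  [m∸3]/2<k⇒m≤2[1+k] {k} x/2<k = begin
    m                         ≡⟨ trans m≡3+x (cong (3 +_) (m≡m%n+[m/n]*n x 2)) ⟩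
    3 + (x % 2 + x / 2 * 2)   ≤⟨ ℕₚ.+-monoʳ-≤ 3 (ℕₚ.+-monoˡ-≤ (x / 2 * 2) (ℕₚ.≤-pred (m%n<n x 2))) ⟩
    2 + suc (x / 2) * 2       ≤⟨ ℕₚ.+-monoʳ-≤ 2 (ℕₚ.*-monoˡ-≤ 2 x/2<k) ⟩
    2 + k * 2                 ≡⟨ cong (2 +_) (ℕₚ.*-comm k 2) ⟩
    2 + 2 * k                 ≡⟨ sym (ℕₚ.*-suc 2 k) ⟩
    2 * suc k                 ∎
    where open ℕₚ.≤-Reasoning

theorem3p1 : ∀ (n : ℕ) → 5 ≤ n → MobIs (Kneser n 2) (4 ⊔ ((n ∸ 3) / 2))
theorem3p1 n 5≤n = lower , upper
  where
  open StarMobile n 5≤n using (star-mobile)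
  open CliqueMobile n 5≤n using (clique-mobile)
  open UpperBound n 5≤n using (no-mobile-of-size)
  q = (n ∸ 3) / 2
  3≤n = ℕₚ.≤-trans (s≤s (s≤s (s≤s z≤n))) 5≤n
  lower : ∃[ S ] IsMobileGeneralPosition (Kneser n 2) S × length S ≡ 4 ⊔ q
  lower with q ≤? 4
  ... | yes q≤4 = let (S , mobile , |S|≡4) = star-mobile in S , mobile , trans |S|≡4 (sym (ℕₚ.m≥n⇒m⊔n≡m q≤4))
  ... | no q≰4 = let (S , mobile , |S|≡q) = clique-mobile (2*[m∸3]/2+3≤m n 3≤n) (ℕₚ.≤-trans (s≤s z≤n) 4<q)
                 in S , mobile , trans |S|≡q (sym (ℕₚ.m≤n⇒m⊔n≡n (ℕₚ.<⇒≤ 4<q)))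
    where 4<q = ℕₚ.≰⇒> q≰4
  upper : ∀ S → IsMobileGeneralPosition (Kneser n 2) S → length S ≤ 4 ⊔ q
  upper S mobile with length S ≤? 4 ⊔ q
  ... | yes |S|≤ = |S|≤
  ... | no |S|≰ = ⊥-elim (no-mobile-of-size (ℕₚ.m⊔n<o⇒m<o 4 q too-big)
                            ([m∸3]/2<k⇒m≤2[1+k] n 3≤n (ℕₚ.m⊔n<o⇒n<o 4 q too-big)) mobile refl)
    where too-big = ℕₚ.≰⇒> |S|≰
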